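{- Let $\Gamma=(V,E)$ be a graph with no isolated vertices and constant edge-multiplicity $\lambda$, and let $G\leq\mathrm{Aut}\,\Gamma$ be a cyclic subgroup transitive on $E$. Then (a) $\Gamma=r\Gamma_0$, where $\Gamma$ has $r$ connected components, each isomorphic to $\Gamma_0$; and (b) if $G_0$ is the setwise stabiliser in $G$ of a component, then $|G|=r|G_0|$, and either $\Gamma_0\cong\mathbf{K}_2^{(\lambda)}$, or $\Gamma_0\cong\mathbf{C}_n^{(\lambda)}$ with $n\geq3$ and $|G_0|=n\lambda$, or $\Gamma_0\cong\mathbf{K}_{s,t}^{(\lambda)}$ with $\gcd(s,t)=1$, $st>1$ and $|G_0|=st\lambda$.
   Context: Graphs are finite, loopless, possibly with multiple edges; automorphisms permute $V\cup E$ preserving $V$, $E$ and incidence. Constant edge-multiplicity $\lambda$: any two adjacent vertices are joined by exactly $\lambda$ edges. $\Gamma^{(\lambda)}$ replaces each edge by $\lambda$ parallel edges; $\mathbf{K}_2$ is a single edge, $\mathbf{C}_n$ the simple $n$-cycle, $\mathbf{K}_{s,t}$ the simple complete bipartite graph; $r\Gamma_0$ is the disjoint union of $r$ copies of $\Gamma_0$. -}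

module Defs where

open import Data.Nat using (ℕ; zero; suc; _+_; _*_; _≤_; _<_)
open import Data.Nat.DivMod using (_%_; m%n<n)
open import Data.Fin using (Fin; toℕ; fromℕ<; _≟_)

open import Data.List using (List; filter; length; allFin)
open import Data.Product using (Σ; ∃; _×_; _,_; proj₁; proj₂)
open import Data.Sum using (_⊎_; inj₁; inj₂)
open import Data.Irrelevant using (Irrelevant)
open import Function using (_∘_; id)
open import Function.Bundles using (_↔_; _⇔_; Inverse)
open import Relation.Nullary using (¬_)
open import Relation.Nullary.Decidable using (_×-dec_; _⊎-dec_)
open import Relation.Binary.PropositionalEquality using (_≡_; _≢_)

record Graph : Set₁ where
  field
    V    : Set
    E    : Set
    ends : E → V × V

open Graph public

Inc : (Γ : Graph) → E Γ → V Γ → Set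
Inc Γ e v = (v ≡ proj₁ (ends Γ e)) ⊎ (v ≡ proj₂ (ends Γ e))

record Iso (Γ Δ : Graph) : Set where
  field
    isoV : V Γ ↔ V Δ
    isoE : E Γ ↔ E Δ
    inc  : ∀ e v → Inc Γ e v ⇔ Inc Δ (Inverse.to isoE e) (Inverse.to isoV v)

record FinGraph : Set where
  field
    nv   : ℕ
    ne   : ℕ
    fends : Fin ne → Fin nv × Fin nv

open FinGraph public

toGraph : FinGraph → Graph
toGraph Γ = record { V = Fin (nv Γ) ; E = Fin (ne Γ) ; ends = fends Γ }

Loopless : FinGraph → Set
Loopless Γ = ∀ e → proj₁ (fends Γ e) ≢ proj₂ (fends Γ e)

NoIsolated : FinGraph → Set
NoIsolated Γ = ∀ v → ∃ λ e → Inc (toGraph Γ) e v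

Joins : (Γ : FinGraph) → Fin (ne Γ) → Fin (nv Γ) → Fin (nv Γ) → Set
Joins Γ e u v = (proj₁ (fends Γ e) ≡ u × proj₂ (fends Γ e) ≡ v)
              ⊎ (proj₁ (fends Γ e) ≡ v × proj₂ (fends Γ e) ≡ u)

mult : (Γ : FinGraph) → Fin (nv Γ) → Fin (nv Γ) → ℕ
mult Γ u v = length (filter (λ e → let (a , b) = fends Γ e in
                                   ((a ≟ u) ×-dec (b ≟ v)) ⊎-dec ((a ≟ v) ×-dec (b ≟ u)))
                            (allFin (ne Γ)))

Adjacent : (Γ : FinGraph) → Fin (nv Γ) → Fin (nv Γ) → Set
Adjacent Γ u v = ∃ λ e → Joins Γ e u v

ConstMult : FinGraph → ℕ → Set
ConstMult Γ μ = ∀ u v → Adjacent Γ u v → mult Γ u v ≡ μ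

data Conn (Γ : FinGraph) (v : Fin (nv Γ)) : Fin (nv Γ) → Set where
  here : Conn Γ v v
  step : ∀ {u w} → Conn Γ v u → Adjacent Γ u w → Conn Γ v w

step-end : (Γ : FinGraph) {v : Fin (nv Γ)} (e : Fin (ne Γ)) →
           Conn Γ v (proj₁ (fends Γ e)) → Conn Γ v (proj₂ (fends Γ e))
step-end Γ e c = step c (e , inj₁ (_≡_.refl , _≡_.refl))

-- The connected component of Γ containing v, as a graph: vertices connected
-- to v, and edges whose (first, hence both) ends are connected to v.
Component : (Γ : FinGraph) → Fin (nv Γ) → Graph
Component Γ v = record
  { V    = Σ (Fin (nv Γ)) (λ u → Irrelevant (Conn Γ v u))
  ; E    = Σ (Fin (ne Γ)) (λ e → Irrelevant (Conn Γ v (proj₁ (fends Γ e))))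
  ; ends = λ { (e , p) → (proj₁ (fends Γ e) , p)
                       , (proj₂ (fends Γ e) , Data.Irrelevant.map (step-end Γ e) p) }
  }

NumComponents : FinGraph → ℕ → Set
NumComponents Γ r = Σ (Fin r → Fin (nv Γ)) λ rep →
  (∀ i j → Conn Γ (rep i) (rep j) → i ≡ j) × (∀ v → ∃ λ i → Conn Γ (rep i) v)

Aut : FinGraph → Set
Aut Γ = Iso (toGraph Γ) (toGraph Γ)

gV : {Γ : FinGraph} → Aut Γ → Fin (nv Γ) → Fin (nv Γ)
gV g = Inverse.to (Iso.isoV g)

gE : {Γ : FinGraph} → Aut Γ → Fin (ne Γ) → Fin (ne Γ)
gE g = Inverse.to (Iso.isoE g)

iter : {A : Set} → (A → A) → ℕ → A → A
iter f zero    = id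
iter f (suc k) = f ∘ iter f k

PowIsId : {Γ : FinGraph} → Aut Γ → ℕ → Set
PowIsId g k = (∀ v → iter (gV g) k v ≡ v) × (∀ e → iter (gE g) k e ≡ e)

IsOrder : {Γ : FinGraph} → Aut Γ → ℕ → Set
IsOrder g m = 1 ≤ m × PowIsId g m × (∀ k → 1 ≤ k → k < m → ¬ PowIsId g k)

EdgeTransitive : {Γ : FinGraph} → Aut Γ → Set
EdgeTransitive g = ∀ e e′ → ∃ λ k → iter (gE g) k e ≡ e′

StabComp : {Γ : FinGraph} → Aut Γ → Fin (nv Γ) → ℕ → Set
StabComp {Γ} g v k = ∀ u → Conn Γ v u ⇔ Conn Γ v (iter (gV g) k u)

-- When g has order m, the elements of ⟨g⟩ are g^k for k < m (distinct);
-- the stabiliser G₀ of the component of v has cardinality c.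
StabCard : {Γ : FinGraph} → Aut Γ → ℕ → Fin (nv Γ) → ℕ → Set
StabCard g m v c = Fin c ↔ Σ (Fin m) (λ k → Irrelevant (StabComp g v (toℕ k)))

K2 : ℕ → Graph
K2 μ = record { V = Fin 2 ; E = Fin μ ; ends = λ _ → (Fin.zero , Fin.suc Fin.zero) }
  where import Data.Fin as Fin

cycNext : (n : ℕ) → Fin (suc n) → Fin (suc n)
cycNext n i = fromℕ< (m%n<n (suc (toℕ i)) (suc n))

Cycle : ℕ → ℕ → Graph
Cycle zero μ = record { V = Fin 0 ; E = Fin 0 ; ends = λ () }
Cycle (suc n′) μ = record
  { V = Fin (suc n′) ; E = Fin (suc n′) × Fin μ
  ; ends = λ { (i , _) → (i , cycNext n′ i) } }

Kst : ℕ → ℕ → ℕ → Graph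
Kst s t μ = record
  { V = Fin s ⊎ Fin t ; E = Fin s × Fin t × Fin μ
  ; ends = λ { (i , j , _) → (inj₁ i , inj₂ j) } }

{-# OPTIONS --safe #-}
module Submission where

open import Defs
open import Data.Nat using (ℕ; zero; suc; _+_; _*_; _∸_; _≤_; _<_; z≤n; s≤s; s≤s⁻¹; NonZero; >-nonZero; >-nonZero⁻¹; _≤?_)
open import Data.Nat.Properties
open import Data.Nat.DivMod
open import Data.Nat.Divisibility using (_∣_; divides; _∣?_; m%n≡0⇒n∣m; n∣m⇒m%n≡0; ∣⇒≤)
open import Data.Nat.GCD
open import Data.Nat.Tactic.RingSolver using (solve-∀)
open import Data.Fin using (Fin; toℕ; fromℕ<; cast)
import Data.Fin as Fin
import Data.Fin.Properties as Finₚ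
open import Data.Fin.Permutation using (↔⇒≡)
open import Data.Product using (Σ; ∃; ∃₂; _×_; _,_; proj₁; proj₂)
open import Data.Product.Properties using (,-injectiveˡ)
open import Data.Product.Algebra using (×-assoc)
open import Data.Product.Function.Dependent.Propositional using (Σ-↔)
open import Data.Product.Function.NonDependent.Propositional using (_×-↔_)
open import Data.Sum using (_⊎_; inj₁; inj₂)
import Data.Sum as Sum
import Data.Sum.Properties as Sumₚ
open import Data.Empty using (⊥; ⊥-elim)
open import Data.Irrelevant using (Irrelevant; [_])
open import Data.List using (List; []; _∷_; filter; length; allFin; lookup)
open import Data.List.Relation.Unary.Any as Any using (here; there)
import Data.List.Relation.Unary.All as All
open import Data.List.Relation.Unary.AllPairs using (_∷_)
open import Data.List.Membership.Propositional using (_∈_)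
open import Data.List.Membership.Propositional.Properties using (∈-filter⁺; ∈-filter⁻; ∈-allFin; ∈-lookup)
open import Data.List.Relation.Unary.Any.Properties using (lookup-index)
open import Data.List.Relation.Unary.Unique.Propositional using (Unique)
import Data.List.Relation.Unary.Unique.Propositional.Properties as Uniqueₚ
open import Function using (_∘_; id)
open import Function.Bundles using (_↔_; _⇔_; Inverse; Injection; Equivalence; mk⇔; mk↔ₛ′)
open import Function.Properties.Inverse using (↔-refl; ↔-sym; ↔-trans; ↔⇒↣)
open import Level using (0ℓ)
open import Relation.Nullary using (¬_; yes; no)
open import Relation.Nullary.Decidable using (recompute; _×-dec_; _⊎-dec_)
open import Relation.Unary using (Decidable)
open import Relation.Binary using (DecidableEquality; tri<; tri≈; tri>)
open import Relation.Binary.PropositionalEquality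
  using (_≡_; _≢_; refl; sym; trans; cong; cong₂; subst; subst₂; module ≡-Reasoning)

-- Fix an edge e₀ with ends a₀, b₀, and let σ, τ be the actions of the generator g on vertices
-- and edges.  By edge-transitivity every edge is τᵏ e₀, joining x k = σᵏ a₀ and y k = σᵏ b₀, so
-- every vertex is some x k or y k.  Suppose d is such that k mod d is a well-defined label of the
-- vertices x k, y k and a₀ is connected to σᵈ a₀.  Then the label is exactly the component: there
-- are d components, the stabiliser of a component is ⟨gᵈ⟩ of order |G|/d, and if no element of G
-- reverses e₀ it acts regularly on the edges of the component.  Let p, q be the σ-periods of a₀, b₀.
-- If b₀ = σᵃ a₀, take d = gcd a p: a component is an orbit of h = σᵃ, and is K₂ or a cycle of length
-- at least 3.  Otherwise no edge joins two x's or two y's, d = gcd p q, and a component is K_{s,t}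
-- with s = p/d and t = q/d coprime.  In both cases Bézout's identity connects a₀ to σᵈ a₀, and the
-- multiplicity μ says that each pair of adjacent vertices carries exactly μ edges of the component.

-- Iteration and minimal periods

module _ {A : Set} (f : A → A) where

  iter-+ : ∀ i j x → iter f (i + j) x ≡ iter f i (iter f j x)
  iter-+ zero    j x = refl
  iter-+ (suc i) j x = cong f (iter-+ i j x)

  iter-comm : ∀ i j x → iter f i (iter f j x) ≡ iter f j (iter f i x)
  iter-comm i j x = begin
    iter f i (iter f j x) ≡⟨ iter-+ i j x ⟨
    iter f (i + j) x      ≡⟨ cong (λ k → iter f k x) (+-comm i j) ⟩
    iter f (j + i) x      ≡⟨ iter-+ j i x ⟩
    iter f j (iter f i x) ∎
    where open ≡-Reasoning

  iter-iter : ∀ a i x → iter (iter f a) i x ≡ iter f (i * a) x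
  iter-iter a zero    x = refl
  iter-iter a (suc i) x = trans (cong (iter f a) (iter-iter a i x)) (sym (iter-+ a (i * a) x))

  iter-injective : (∀ {x y} → f x ≡ f y → x ≡ y) → ∀ k {x y} → iter f k x ≡ iter f k y → x ≡ y
  iter-injective inj zero    eq = eq
  iter-injective inj (suc k) eq = iter-injective inj k (inj eq)

  module _ {p x} (fixed : iter f p x ≡ x) where

    iter-*-fixed : ∀ w → iter f (w * p) x ≡ x
    iter-*-fixed zero    = refl
    iter-*-fixed (suc w) = trans (iter-+ p (w * p) x) (trans (cong (iter f p) (iter-*-fixed w)) fixed)

    iter-+*-fixed : ∀ i w → iter f (i + w * p) x ≡ iter f i x
    iter-+*-fixed i w = trans (iter-+ i (w * p) x) (cong (iter f i) (iter-*-fixed w))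

    iter-%-fixed : .{{_ : NonZero p}} → ∀ i → iter f i x ≡ iter f (i % p) x
    iter-%-fixed i = trans (cong (λ k → iter f k x) (m≡m%n+[m/n]*n i p)) (iter-+*-fixed (i % p) (i / p))

module _ {Q : ℕ → Set} (Q? : Decidable Q) where

  private
    search : ∀ k gap → (∀ i → i < k → ¬ Q i) → Q (gap + k) → ∃ λ m → Q m × (∀ i → i < m → ¬ Q i)
    search k gap below q with Q? k
    ... | yes qk = k , qk , below
    search k zero      below q | no ¬qk = ⊥-elim (¬qk q)
    search k (suc gap) below q | no ¬qk = search (suc k) gap below′ (subst Q (sym (+-suc gap k)) q)
      where
        below′ : ∀ i → i < suc k → ¬ Q i
        below′ i i<1+k with m≤n⇒m<n∨m≡n (s≤s⁻¹ i<1+k)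
        ... | inj₁ i<k  = below i i<k
        ... | inj₂ refl = ¬qk

  least-witness : ∀ {n} → Q n → ∃ λ m → Q m × (∀ i → i < m → ¬ Q i)
  least-witness {n} q = search 0 n (λ _ ()) (subst Q (sym (+-identityʳ n)) q)

module Period {N : ℕ} (f : Fin N → Fin N) (f-injective : ∀ {x y} → f x ≡ f y → x ≡ y) where

  IsPeriod : Fin N → ℕ → Set
  IsPeriod x p = 1 ≤ p × iter f p x ≡ x

  private
    IsPeriod? : ∀ x → Decidable (IsPeriod x)
    IsPeriod? x p with 1 ≤? p | iter f p x Finₚ.≟ x
    ... | yes 1≤p | yes fixed = yes (1≤p , fixed)
    ... | no  1≰p | _         = no (λ per → 1≰p (proj₁ per))
    ... | _       | no ¬fixed = no (λ per → ¬fixed (proj₂ per))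

    some-period : ∀ x → ∃ (IsPeriod x)
    some-period x with Finₚ.pigeonhole (n<1+n N) (λ (i : Fin (suc N)) → iter f (toℕ i) x)
    ... | i , j , i<j , eq = toℕ j ∸ toℕ i , m<n⇒0<n∸m i<j , iter-injective f f-injective (toℕ i) fixed
      where
        fixed : iter f (toℕ i) (iter f (toℕ j ∸ toℕ i) x) ≡ iter f (toℕ i) x
        fixed = trans (sym (iter-+ f (toℕ i) (toℕ j ∸ toℕ i) x))
                      (trans (cong (λ k → iter f k x) (m+[n∸m]≡n (<⇒≤ i<j))) (sym eq))

  -- The period is suc pred-period, so that reducing modulo it needs no NonZero argument.
  record MinimalPeriod (x : Fin N) : Set where
    field
      pred-period : ℕ
      periodic    : iter f (suc pred-period) x ≡ x
      minimal     : ∀ j → 1 ≤ j → j < suc pred-period → iter f j x ≢ x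

  abstract
    minimalPeriod : ∀ x → MinimalPeriod x
    minimalPeriod x with least-witness (IsPeriod? x) (proj₂ (some-period x))
    ... | zero   , (() , _)         , _
    ... | suc p′ , (_ , periodic) , below = record
      { pred-period = p′ ; periodic = periodic ; minimal = λ j 1≤j j<p fixed → below j j<p (1≤j , fixed) }

  module _ {x : Fin N} (P : MinimalPeriod x) where
    open MinimalPeriod P

    private
      p : ℕ
      p = suc pred-period

      no-earlier-return : ∀ i j → i < j → j < p → iter f i x ≢ iter f j x
      no-earlier-return i j i<j j<p eq = minimal (j ∸ i) (m<n⇒0<n∸m i<j) (≤-<-trans (m∸n≤m j i) j<p)
        (iter-injective f f-injective i (begin
          iter f i (iter f (j ∸ i) x) ≡⟨ iter-+ f i (j ∸ i) x ⟨
          iter f (i + (j ∸ i)) x      ≡⟨ cong (λ k → iter f k x) (m+[n∸m]≡n (<⇒≤ i<j)) ⟩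
          iter f j x                  ≡⟨ eq ⟨
          iter f i x                  ∎))
        where open ≡-Reasoning

    iter-≡⇒%-≡ : ∀ i j → iter f i x ≡ iter f j x → i % p ≡ j % p
    iter-≡⇒%-≡ i j eq with <-cmp (i % p) (j % p)
    ... | tri≈ _ i≡j _ = i≡j
    ... | tri< i<j _ _ = ⊥-elim (no-earlier-return _ _ i<j (m%n<n j p)
          (trans (sym (iter-%-fixed f periodic i)) (trans eq (iter-%-fixed f periodic j))))
    ... | tri> _ _ j<i = ⊥-elim (no-earlier-return _ _ j<i (m%n<n i p)
          (trans (sym (iter-%-fixed f periodic j)) (trans (sym eq) (iter-%-fixed f periodic i))))

    %-≡⇒iter-≡ : ∀ i j → i % p ≡ j % p → iter f i x ≡ iter f j x
    %-≡⇒iter-≡ i j eq =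
      trans (iter-%-fixed f periodic i) (trans (cong (λ k → iter f k x) eq) (sym (iter-%-fixed f periodic j)))

-- Arithmetic

private
  bezout-+- : ∀ {d p e} X W → d + W * p ≡ X * e → X * e + p ≡ d + suc W * p
  bezout-+- {d} {p} {e} X W eq = begin
    X * e + p       ≡⟨ cong (_+ p) eq ⟨
    d + W * p + p   ≡⟨ +-assoc d (W * p) p ⟩
    d + (W * p + p) ≡⟨ cong (d +_) (+-comm (W * p) p) ⟩
    d + suc W * p   ∎
    where open ≡-Reasoning

  bezout--+ : ∀ {d p e} X W s → p ≡ suc s * d → d + X * e ≡ W * p → s * X * e + p ≡ d + s * W * p
  bezout--+ {d} {p} {e} X W s refl eq = begin
    s * X * e + suc s * d   ≡⟨ expand s X e d ⟩
    d + s * (d + X * e)     ≡⟨ cong (λ z → d + s * z) eq ⟩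
    d + s * (W * p)         ≡⟨ cong (d +_) (*-assoc s W p) ⟨
    d + s * W * p           ∎
    where
      open ≡-Reasoning
      expand : ∀ s X e d → s * X * e + suc s * d ≡ d + s * (d + X * e)
      expand = solve-∀

-- X e ≡ gcd e p (mod p), stated without subtraction.
bezout-mod : ∀ e p′ d′ → gcd e (suc p′) ≡ suc d′ → ∃₂ λ X W → X * e + suc p′ ≡ suc d′ + W * suc p′
bezout-mod e p′ d′ gcd≡ with Bézout.identity (gcd-GCD e (suc p′)) | subst (_∣ suc p′) gcd≡ (gcd[m,n]∣n e (suc p′))
... | Bézout.+- X W eq | _ =
  X , suc W , bezout-+- X W (subst (λ z → z + W * suc p′ ≡ X * e) gcd≡ eq)
... | Bézout.-+ X W eq | divides (suc s) p≡ =
  s * X , s * W , bezout--+ X W s p≡ (subst (λ z → z + X * e ≡ W * suc p′) gcd≡ eq)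

≡-mod-divisor : ∀ {d p} .{{_ : NonZero d}} .{{_ : NonZero p}} → d ∣ p → ∀ i j → i % p ≡ j % p → i % d ≡ j % d
≡-mod-divisor {d} {p} d∣p i j eq =
  trans (sym (m∣n⇒o%n%m≡o%m d p i d∣p)) (trans (cong (_% d) eq) (m∣n⇒o%n%m≡o%m d p j d∣p))

[c+αd]/d≡α : ∀ {c d} .{{_ : NonZero d}} α → c < d → (c + α * d) / d ≡ α
[c+αd]/d≡α {c} {d} α c<d = trans (+-distrib-/-∣ʳ c (divides α refl)) (cong₂ _+_ (m<n⇒m/n≡0 c<d) (m*n/n≡m α d))

c+αd<sd : ∀ {c d α s} → c < d → α < s → c + α * d < s * d
c+αd<sd {c} {d} {α} c<d α<s = ≤-trans (+-monoˡ-< (α * d) c<d) (*-monoˡ-≤ d α<s)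

-- If X q ≡ d (mod p) then A X q + c ≡ c + A d (mod p), with both sides moved so that no subtraction occurs.
≡-mod-scale : ∀ A c {X q p d W} → X * q + p ≡ d + W * p → A * X * q + c + A * p ≡ c + A * d + A * W * p
≡-mod-scale A c {X} {q} {p} {d} {W} eq = begin
  A * X * q + c + A * p ≡⟨ expand A X q c p ⟩
  c + A * (X * q + p)   ≡⟨ cong (λ z → c + A * z) eq ⟩
  c + A * (d + W * p)   ≡⟨ collect A c d W p ⟩
  c + A * d + A * W * p ∎
  where
    open ≡-Reasoning
    expand : ∀ A X q c p → A * X * q + c + A * p ≡ c + A * (X * q + p)
    expand = solve-∀
    collect : ∀ A c d W p → c + A * (d + W * p) ≡ c + A * d + A * W * p
    collect = solve-∀

m*n≤1⇒m≡1×n≡1 : ∀ {m n} → 0 < m → 0 < n → m * n ≤ 1 → m ≡ 1 × n ≡ 1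
m*n≤1⇒m≡1×n≡1 {m} {n} 0<m 0<n mn≤1 =
    ≤-antisym (≤-trans (m≤m*n m n ⦃ >-nonZero 0<n ⦄) mn≤1) 0<m
  , ≤-antisym (≤-trans (m≤n*m n m ⦃ >-nonZero 0<m ⦄) mn≤1) 0<n

gcd≡suc : ∀ m n → n ≢ 0 → ∃ λ d′ → gcd m n ≡ suc d′
gcd≡suc m n n≢0 with gcd m n | gcd[m,n]≢0 m n (inj₂ n≢0)
... | zero   | gcd≢0 = ⊥-elim (gcd≢0 refl)
... | suc d′ | _     = d′ , refl

-- Bijections, isomorphisms and connectivity

Σ-irrelevant-≡ : ∀ {A : Set} {B : A → Set} {a a′ : A} {b : Irrelevant (B a)} {b′ : Irrelevant (B a′)} →
                 a ≡ a′ → _≡_ {A = Σ A (λ z → Irrelevant (B z))} (a , b) (a′ , b′)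
Σ-irrelevant-≡ refl = refl

multiples-below↔ : ∀ {d m} .{{_ : NonZero d}} {P : ℕ → Set} → (∀ k → P k ⇔ d ∣ k) → d ∣ m →
                   Fin (m / d) ↔ Σ (Fin m) (λ k → Irrelevant (P (toℕ k)))
multiples-below↔ {d} {m} {P} P⇔∣ d∣m = mk↔ₛ′ to from to∘from from∘to
  where
    i*d<m : (i : Fin (m / d)) → toℕ i * d < m
    i*d<m i = subst (toℕ i * d <_) (m/n*n≡m d∣m) (*-monoˡ-< d (Finₚ.toℕ<n i))

    k/d<m/d : (k : Fin m) → toℕ k / d < m / d
    k/d<m/d k = m<n*o⇒m/o<n (subst (toℕ k <_) (sym (m/n*n≡m d∣m)) (Finₚ.toℕ<n k))

    to : Fin (m / d) → Σ (Fin m) (λ k → Irrelevant (P (toℕ k)))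
    to i = fromℕ< (i*d<m i)
         , [ subst P (sym (Finₚ.toℕ-fromℕ< (i*d<m i))) (Equivalence.from (P⇔∣ _) (divides (toℕ i) refl)) ]

    from : Σ (Fin m) (λ k → Irrelevant (P (toℕ k))) → Fin (m / d)
    from (k , _) = fromℕ< (k/d<m/d k)

    to∘from : ∀ k → to (from k) ≡ k
    to∘from (k , [ p ]) = Σ-irrelevant-≡ (Finₚ.toℕ-injective (begin
      toℕ (fromℕ< (i*d<m (fromℕ< (k/d<m/d k)))) ≡⟨ Finₚ.toℕ-fromℕ< _ ⟩
      toℕ (fromℕ< (k/d<m/d k)) * d              ≡⟨ cong (_* d) (Finₚ.toℕ-fromℕ< (k/d<m/d k)) ⟩
      toℕ k / d * d                             ≡⟨ m/n*n≡m (recompute (d ∣? toℕ k) (Equivalence.to (P⇔∣ _) p)) ⟩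
      toℕ k                                     ∎))
      where open ≡-Reasoning

    from∘to : ∀ i → from (to i) ≡ i
    from∘to i = Finₚ.toℕ-injective (begin
      toℕ (fromℕ< (k/d<m/d (fromℕ< (i*d<m i)))) ≡⟨ Finₚ.toℕ-fromℕ< _ ⟩
      toℕ (fromℕ< (i*d<m i)) / d                ≡⟨ cong (_/ d) (Finₚ.toℕ-fromℕ< (i*d<m i)) ⟩
      toℕ i * d / d                             ≡⟨ m*n/n≡m (toℕ i) d ⟩
      toℕ i                                     ∎)
      where open ≡-Reasoning

iso-refl : ∀ {Γ} → Iso Γ Γ
iso-refl = record { isoV = ↔-refl ; isoE = ↔-refl ; inc = λ _ _ → mk⇔ id id }

iso-trans : ∀ {Γ Δ Θ} → Iso Γ Δ → Iso Δ Θ → Iso Γ Θ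
iso-trans f h = record
  { isoV = ↔-trans (Iso.isoV f) (Iso.isoV h)
  ; isoE = ↔-trans (Iso.isoE f) (Iso.isoE h)
  ; inc  = λ e v → mk⇔ (Equivalence.to (Iso.inc h _ _) ∘ Equivalence.to (Iso.inc f e v))
                       (Equivalence.from (Iso.inc f e v) ∘ Equivalence.from (Iso.inc h _ _))
  }

module Connectivity (Γ : FinGraph) where

  _~_ : Fin (nv Γ) → Fin (nv Γ) → Set
  _~_ = Conn Γ

  joins-sym : ∀ {e u w} → Joins Γ e u w → Joins Γ e w u
  joins-sym (inj₁ ends) = inj₂ ends
  joins-sym (inj₂ ends) = inj₁ ends

  adjacent-sym : ∀ {u w} → Adjacent Γ u w → Adjacent Γ w u
  adjacent-sym (e , j) = e , joins-sym j

  adjacent⇒~ : ∀ {u w} → Adjacent Γ u w → u ~ w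
  adjacent⇒~ = step here

  ~-trans : ∀ {u v w} → u ~ v → v ~ w → u ~ w
  ~-trans c here       = c
  ~-trans c (step d a) = step (~-trans c d) a

  ~-sym : ∀ {u w} → u ~ w → w ~ u
  ~-sym here       = here
  ~-sym (step c a) = ~-trans (adjacent⇒~ (adjacent-sym a)) (~-sym c)

  ~⇒component-iso : ∀ {v w} → v ~ w → Iso (Component Γ v) (Component Γ w)
  ~⇒component-iso {v} {w} v~w = record
    { isoV = mk↔ₛ′ (λ { (u , [ c ]) → u , [ ~-trans w~v c ] }) (λ { (u , [ c ]) → u , [ ~-trans v~w c ] })
                   (λ _ → refl) (λ _ → refl)
    ; isoE = mk↔ₛ′ (λ { (e , [ c ]) → e , [ ~-trans w~v c ] }) (λ { (e , [ c ]) → e , [ ~-trans v~w c ] })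
                   (λ _ → refl) (λ _ → refl)
    ; inc  = λ { (e , [ _ ]) (u , [ _ ]) → mk⇔ (Sum.map transport transport) (Sum.map transport transport) }
    }
    where
      w~v : w ~ v
      w~v = ~-sym v~w
      transport : ∀ {A : Set} {B B′ : A → Set} {a a′ : A} {b : Irrelevant (B a)} {b′ : Irrelevant (B a′)}
                    {c : Irrelevant (B′ a)} {c′ : Irrelevant (B′ a′)} →
                  _≡_ {A = Σ A (λ z → Irrelevant (B z))} (a , b) (a′ , b′) →
                  _≡_ {A = Σ A (λ z → Irrelevant (B′ z))} (a , c) (a′ , c′)
      transport eq = Σ-irrelevant-≡ (,-injectiveˡ eq)

-- Components modelled on blow-ups of simple graphs

index-of-lookup : ∀ {A : Set} {xs : List A} {z : A} → Unique xs → (z∈xs : z ∈ xs) (i : Fin (length xs)) →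
                  lookup xs i ≡ z → Any.index z∈xs ≡ i
index-of-lookup         _          (here refl) Fin.zero    _  = refl
index-of-lookup         (z∉ ∷ _)   (here refl) (Fin.suc i) eq = ⊥-elim (All.lookup z∉ (∈-lookup i) (sym eq))
index-of-lookup         (z∉ ∷ _)   (there z∈)  Fin.zero    eq = ⊥-elim (All.lookup z∉ z∈ eq)
index-of-lookup {xs = _ ∷ _} (_ ∷ u) (there z∈) (Fin.suc i) eq = cong Fin.suc (index-of-lookup u z∈ i eq)

-- M is the μ-fold blow-up of the simple graph on V M whose edges are the pairs src p — tgt p.
record Blowup (μ : ℕ) (M : Graph) : Set₁ where
  field
    Pair           : Set
    src tgt        : Pair → V M
    edges↔         : E M ↔ (Pair × Fin μ)
    ends-edge      : ∀ z → ends M z ≡ (src (proj₁ (Inverse.to edges↔ z)) , tgt (proj₁ (Inverse.to edges↔ z)))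
    _≟V_           : DecidableEquality (V M)
    pair-injective : ∀ p p′ → (src p ≡ src p′ × tgt p ≡ tgt p′) ⊎ (src p ≡ tgt p′ × tgt p ≡ src p′) → p ≡ p′

  Spans : Pair → V M → V M → Set
  Spans p w w′ = (src p ≡ w × tgt p ≡ w′) ⊎ (src p ≡ w′ × tgt p ≡ w)

module ComponentModel (Γ : FinGraph) (μ : ℕ) (constMult : ConstMult Γ μ) where
  open Connectivity Γ

  private
    joins? : ∀ u w → Decidable (λ e → Joins Γ e u w)
    joins? u w e = let (a , b) = fends Γ e in
      ((a Finₚ.≟ u) ×-dec (b Finₚ.≟ w)) ⊎-dec ((a Finₚ.≟ w) ×-dec (b Finₚ.≟ u))

    -- mult Γ u w is, by definition, the length of this list.
    joining : Fin (nv Γ) → Fin (nv Γ) → List (Fin (ne Γ))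
    joining u w = filter (joins? u w) (allFin (ne Γ))

    ∈-joining⁺ : ∀ {e u w} → Joins Γ e u w → e ∈ joining u w
    ∈-joining⁺ {e} {u} {w} = ∈-filter⁺ (joins? u w) (∈-allFin e)

    ∈-joining⁻ : ∀ {e u w} → e ∈ joining u w → Joins Γ e u w
    ∈-joining⁻ {u = u} {w} e∈ = proj₂ (∈-filter⁻ (joins? u w) {xs = allFin (ne Γ)} e∈)

    joining-unique : ∀ u w → Unique (joining u w)
    joining-unique u w = Uniqueₚ.filter⁺ (joins? u w) (Uniqueₚ.allFin⁺ (ne Γ))

  module _ {M : Graph} (B : Blowup μ M) where
    open Blowup B

    record Parametrisation (v : Fin (nv Γ)) : Set where
      field
        φ          : V M → Fin (nv Γ)
        φ⁻¹        : Fin (nv Γ) → V M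
        φ⁻¹-φ      : ∀ w → φ⁻¹ (φ w) ≡ w
        φ-φ⁻¹      : ∀ u → v ~ u → φ (φ⁻¹ u) ≡ u
        v~φ        : ∀ w → v ~ φ w
        φ-adjacent : ∀ p → Adjacent Γ (φ (src p)) (φ (tgt p))
        pair       : V M → V M → Pair
        pair-spans : ∀ w w′ → Adjacent Γ (φ w) (φ w′) → Spans (pair w w′) w w′

    module _ {v : Fin (nv Γ)} (P : Parametrisation v) where
      open Parametrisation P

      private
        head tail : Fin (ne Γ) → Fin (nv Γ)
        head e = proj₁ (fends Γ e)
        tail e = proj₂ (fends Γ e)

        v~tail : ∀ e → v ~ head e → v ~ tail e
        v~tail e c = step c (e , inj₁ (refl , refl))

        edges-of : Pair → List (Fin (ne Γ))
        edges-of p = joining (φ (src p)) (φ (tgt p))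

        length-edges-of : ∀ p → length (edges-of p) ≡ μ
        length-edges-of p = constMult _ _ (φ-adjacent p)

        pair-of : Fin (ne Γ) → Pair
        pair-of e = pair (φ⁻¹ (head e)) (φ⁻¹ (tail e))

        spans-pair-of : ∀ e → v ~ head e → Spans (pair-of e) (φ⁻¹ (head e)) (φ⁻¹ (tail e))
        spans-pair-of e c = pair-spans _ _
          (subst₂ (Adjacent Γ) (sym (φ-φ⁻¹ _ c)) (sym (φ-φ⁻¹ _ (v~tail e c))) (e , inj₁ (refl , refl)))

        joins-pair-of : ∀ e → v ~ head e → Joins Γ e (φ (src (pair-of e))) (φ (tgt (pair-of e)))
        joins-pair-of e c with spans-pair-of e c
        ... | inj₁ (s , t) = inj₁ ( trans (sym (φ-φ⁻¹ _ c)) (cong φ (sym s))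
                                  , trans (sym (φ-φ⁻¹ _ (v~tail e c))) (cong φ (sym t)))
        ... | inj₂ (s , t) = inj₂ ( trans (sym (φ-φ⁻¹ _ c)) (cong φ (sym t))
                                  , trans (sym (φ-φ⁻¹ _ (v~tail e c))) (cong φ (sym s)))

        ∈-edges-of : ∀ e → .(v ~ head e) → e ∈ edges-of (pair-of e)
        ∈-edges-of e c = recompute (Any.any? (e Finₚ.≟_) (edges-of (pair-of e))) (∈-joining⁺ (joins-pair-of e c))

        -- An edge of the component is coded by its pair and its position in the list of edges spanning that pair.
        encode : E (Component Γ v) → Pair × Fin μ
        encode (e , [ c ]) = pair-of e , cast (length-edges-of (pair-of e)) (Any.index (∈-edges-of e c))

        decode-edge : Pair → Fin μ → Fin (ne Γ)
        decode-edge p l = lookup (edges-of p) (cast (sym (length-edges-of p)) l)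

        decode-joins : ∀ p l → Joins Γ (decode-edge p l) (φ (src p)) (φ (tgt p))
        decode-joins p l = ∈-joining⁻ (∈-lookup (cast (sym (length-edges-of p)) l))

        v~head-decode : ∀ p l → v ~ head (decode-edge p l)
        v~head-decode p l with decode-joins p l
        ... | inj₁ (a , _) = subst (v ~_) (sym a) (v~φ (src p))
        ... | inj₂ (a , _) = subst (v ~_) (sym a) (v~φ (tgt p))

        decode : Pair × Fin μ → E (Component Γ v)
        decode (p , l) = decode-edge p l , [ v~head-decode p l ]

        pair-of-decode : ∀ p l → pair-of (decode-edge p l) ≡ p
        pair-of-decode p l with decode-joins p l | spans-pair-of (decode-edge p l) (v~head-decode p l)
        ... | inj₁ (a , b) | spans = pair-injective _ _
          (subst₂ (Spans _) (trans (cong φ⁻¹ a) (φ⁻¹-φ _)) (trans (cong φ⁻¹ b) (φ⁻¹-φ _)) spans)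
        ... | inj₂ (a , b) | spans = pair-injective _ _ (Sum.swap
          (subst₂ (Spans _) (trans (cong φ⁻¹ a) (φ⁻¹-φ _)) (trans (cong φ⁻¹ b) (φ⁻¹-φ _)) spans))

        encode-decode-at : ∀ p l p′ → p′ ≡ p → (e∈ : decode-edge p l ∈ edges-of p′) →
                           _≡_ {A = Pair × Fin μ} (p′ , cast (length-edges-of p′) (Any.index e∈)) (p , l)
        encode-decode-at p l .p refl e∈ = cong (p ,_) (Finₚ.toℕ-injective (trans (Finₚ.toℕ-cast _ _)
          (trans (cong toℕ (index-of-lookup (joining-unique _ _) e∈ (cast (sym (length-edges-of p)) l) refl))
                 (Finₚ.toℕ-cast _ _))))

        encode-decode : ∀ q → encode (decode q) ≡ q
        encode-decode (p , l) = encode-decode-at p l (pair-of (decode-edge p l)) (pair-of-decode p l) _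

        decode-encode : ∀ z → decode (encode z) ≡ z
        decode-encode (e , [ c ]) = Σ-irrelevant-≡ (trans
          (cong (lookup (edges-of (pair-of e))) (Finₚ.toℕ-injective
            (trans (Finₚ.toℕ-cast _ _) (Finₚ.toℕ-cast (length-edges-of (pair-of e)) (Any.index (∈-edges-of e c))))))
          (sym (lookup-index (∈-edges-of e c))))

        vertex-bijection : V (Component Γ v) ↔ V M
        vertex-bijection = mk↔ₛ′ (φ⁻¹ ∘ proj₁) (λ w → φ w , [ v~φ w ]) φ⁻¹-φ
          (λ { (u , [ c ]) → Σ-irrelevant-≡ (recompute (φ (φ⁻¹ u) Finₚ.≟ u) (φ-φ⁻¹ u c)) })

        edge-bijection : E (Component Γ v) ↔ E M
        edge-bijection = ↔-trans (mk↔ₛ′ encode decode encode-decode decode-encode) (↔-sym edges↔)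

        ends-pair-of : Fin (ne Γ) → V M × V M
        ends-pair-of e = src (pair-of e) , tgt (pair-of e)

        ends-edge-bijection : ∀ z → ends M (Inverse.to edge-bijection z) ≡ ends-pair-of (proj₁ z)
        ends-edge-bijection z = trans (ends-edge _)
          (cong (λ r → src (proj₁ r) , tgt (proj₁ r)) (Inverse.strictlyInverseˡ edges↔ (encode z)))

        OneOf : {A : Set} → A → A × A → Set
        OneOf w ab = w ≡ proj₁ ab ⊎ w ≡ proj₂ ab

        end⇒φ⁻¹-end : ∀ e u → v ~ head e → OneOf u (fends Γ e) → OneOf (φ⁻¹ u) (ends-pair-of e)
        end⇒φ⁻¹-end e u c u≡ with spans-pair-of e c | u≡
        ... | inj₁ (s , t) | inj₁ q = inj₁ (trans (cong φ⁻¹ q) (sym s))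
        ... | inj₁ (s , t) | inj₂ q = inj₂ (trans (cong φ⁻¹ q) (sym t))
        ... | inj₂ (s , t) | inj₁ q = inj₂ (trans (cong φ⁻¹ q) (sym t))
        ... | inj₂ (s , t) | inj₂ q = inj₁ (trans (cong φ⁻¹ q) (sym s))

        φ⁻¹-injective : ∀ {u z} → v ~ u → v ~ z → φ⁻¹ u ≡ φ⁻¹ z → u ≡ z
        φ⁻¹-injective {u} {z} cu cz eq = trans (sym (φ-φ⁻¹ u cu)) (trans (cong φ eq) (φ-φ⁻¹ z cz))

        φ⁻¹-end⇒end : ∀ e u → v ~ head e → v ~ u → OneOf (φ⁻¹ u) (ends-pair-of e) → OneOf u (fends Γ e)
        φ⁻¹-end⇒end e u c cu u≡ with spans-pair-of e c | u≡
        ... | inj₁ (s , t) | inj₁ q = inj₁ (φ⁻¹-injective cu c (trans q s))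
        ... | inj₁ (s , t) | inj₂ q = inj₂ (φ⁻¹-injective cu (v~tail e c) (trans q t))
        ... | inj₂ (s , t) | inj₁ q = inj₂ (φ⁻¹-injective cu (v~tail e c) (trans q s))
        ... | inj₂ (s , t) | inj₂ q = inj₁ (φ⁻¹-injective cu c (trans q t))

      parametrisation⇒iso : Iso (Component Γ v) M
      parametrisation⇒iso = record { isoV = vertex-bijection ; isoE = edge-bijection ; inc = incidence }
        where
          incidence : ∀ z u → Inc (Component Γ v) z u ⇔
                              Inc M (Inverse.to edge-bijection z) (Inverse.to vertex-bijection u)
          incidence (e , [ c ]) (u , [ cu ]) = mk⇔
            (λ i → recompute ((φ⁻¹ u ≟V _) ⊎-dec (φ⁻¹ u ≟V _))
                     (subst (OneOf (φ⁻¹ u)) (sym (ends-edge-bijection (e , [ c ])))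
                            (end⇒φ⁻¹-end e u c (Sum.map ,-injectiveˡ ,-injectiveˡ i))))
            (λ i → Sum.map Σ-irrelevant-≡ Σ-irrelevant-≡ (recompute ((u Finₚ.≟ head e) ⊎-dec (u Finₚ.≟ tail e))
                     (φ⁻¹-end⇒end e u c cu (subst (OneOf (φ⁻¹ u)) (ends-edge-bijection (e , [ c ])) i))))

-- The standard components

Kst-1-1≅K2 : ∀ μ → Iso (Kst 1 1 μ) (K2 μ)
Kst-1-1≅K2 μ = record
  { isoV = mk↔ₛ′ to from (λ { Fin.zero → refl ; (Fin.suc Fin.zero) → refl })
                         (λ { (inj₁ Fin.zero) → refl ; (inj₂ Fin.zero) → refl })
  ; isoE = mk↔ₛ′ (λ { (Fin.zero , Fin.zero , l) → l }) (λ l → Fin.zero , Fin.zero , l)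
                 (λ _ → refl) (λ { (Fin.zero , Fin.zero , l) → refl })
  ; inc  = λ { (Fin.zero , Fin.zero , l) (inj₁ Fin.zero) → mk⇔ (λ _ → inj₁ refl) (λ _ → inj₁ refl)
             ; (Fin.zero , Fin.zero , l) (inj₂ Fin.zero) → mk⇔ (λ _ → inj₂ refl) (λ _ → inj₂ refl) }
  }
  where
    to : Fin 1 ⊎ Fin 1 → Fin 2
    to (inj₁ Fin.zero) = Fin.zero
    to (inj₂ Fin.zero) = Fin.suc Fin.zero
    from : Fin 2 → Fin 1 ⊎ Fin 1
    from Fin.zero           = inj₁ Fin.zero
    from (Fin.suc Fin.zero) = inj₂ Fin.zero

K2-blowup : ∀ μ → Blowup μ (K2 μ)
K2-blowup μ = record
  { Pair           = Fin 1
  ; src            = λ _ → Fin.zero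
  ; tgt            = λ _ → Fin.suc Fin.zero
  ; edges↔         = mk↔ₛ′ (Fin.zero ,_) proj₂ (λ { (Fin.zero , _) → refl ; (Fin.suc () , _) }) (λ _ → refl)
  ; ends-edge      = λ _ → refl
  ; _≟V_           = Finₚ._≟_
  ; pair-injective = λ { Fin.zero Fin.zero _ → refl ; (Fin.suc ()) _ _ ; _ (Fin.suc ()) _ }
  }

Kst-blowup : ∀ s t μ → Blowup μ (Kst s t μ)
Kst-blowup s t μ = record
  { Pair           = Fin s × Fin t
  ; src            = inj₁ ∘ proj₁
  ; tgt            = inj₂ ∘ proj₂
  ; edges↔         = ↔-sym (×-assoc 0ℓ (Fin s) (Fin t) (Fin μ))
  ; ends-edge      = λ _ → refl
  ; _≟V_           = Sumₚ.≡-dec Finₚ._≟_ Finₚ._≟_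
  ; pair-injective = λ { _ _ (inj₁ (refl , refl)) → refl ; _ _ (inj₂ (() , _)) }
  }

private
  toℕ-cycNext : ∀ n′ i → toℕ (cycNext n′ i) ≡ suc (toℕ i) % suc n′
  toℕ-cycNext n′ i = Finₚ.toℕ-fromℕ< (m%n<n (suc (toℕ i)) (suc n′))

  cycNext-toℕ : ∀ n′ i → toℕ (cycNext n′ i) ≡ suc (toℕ i) ⊎ (toℕ i ≡ n′ × toℕ (cycNext n′ i) ≡ 0)
  cycNext-toℕ n′ i with m≤n⇒m<n∨m≡n (s≤s⁻¹ (Finₚ.toℕ<n i))
  ... | inj₁ i<n′ = inj₁ (trans (toℕ-cycNext n′ i) (m<n⇒m%n≡m (s≤s i<n′)))
  ... | inj₂ i≡n′ = inj₂ (i≡n′ , trans (toℕ-cycNext n′ i) (trans (cong (λ k → suc k % suc n′) i≡n′) (n%n≡0 (suc n′))))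

  cycNext²≢id : ∀ n′ → 2 ≤ n′ → ∀ i → cycNext n′ (cycNext n′ i) ≢ i
  cycNext²≢id n′ 2≤n′ i eq with cycNext-toℕ n′ i | cycNext-toℕ n′ (cycNext n′ i)
  ... | inj₁ next | inj₁ next² = <⇒≢ (m<n⇒m<1+n (n<1+n (toℕ i))) (begin
    toℕ i                            ≡⟨ cong toℕ eq ⟨
    toℕ (cycNext n′ (cycNext n′ i))  ≡⟨ next² ⟩
    suc (toℕ (cycNext n′ i))         ≡⟨ cong suc next ⟩
    suc (suc (toℕ i))                ∎)
    where open ≡-Reasoning
  ... | inj₁ next | inj₂ (next≡n′ , next²≡0) =
    <⇒≱ 2≤n′ (≤-reflexive (trans (sym next≡n′) (trans next (cong suc (trans (sym (cong toℕ eq)) next²≡0)))))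
  ... | inj₂ (i≡n′ , next≡0) | _ = <⇒≱ 2≤n′ (subst (_≤ 1) i≡n′ (subst (_≤ 1) (cong toℕ eq) toℕ-next²≤1))
    where
      toℕ-next²≤1 : toℕ (cycNext n′ (cycNext n′ i)) ≤ 1
      toℕ-next²≤1 = subst (_≤ 1) (sym (trans (toℕ-cycNext n′ (cycNext n′ i)) (cong (λ k → suc k % suc n′) next≡0)))
                          (m%n≤m 1 (suc n′))

cycle-blowup : ∀ n′ μ → 2 ≤ n′ → Blowup μ (Cycle (suc n′) μ)
cycle-blowup n′ μ 2≤n′ = record
  { Pair           = Fin (suc n′)
  ; src            = id
  ; tgt            = cycNext n′
  ; edges↔         = ↔-refl
  ; ends-edge      = λ _ → refl
  ; _≟V_           = Finₚ._≟_
  ; pair-injective = λ { _ _ (inj₁ (p≡p′ , _)) → p≡p′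
                       ; p _ (inj₂ (refl , next-p≡p′)) → ⊥-elim (cycNext²≢id n′ 2≤n′ p (cong (cycNext n′) next-p≡p′)) }
  }

Kst-edges↔ : ∀ s t μ → E (Kst s t μ) ↔ Fin (s * t * μ)
Kst-edges↔ s t μ =
  ↔-trans (↔-sym (×-assoc 0ℓ (Fin s) (Fin t) (Fin μ))) (↔-trans (↔-sym Finₚ.*↔× ×-↔ ↔-refl) (↔-sym Finₚ.*↔×))

Cycle-edges↔ : ∀ n′ μ → E (Cycle (suc n′) μ) ↔ Fin (suc n′ * μ)
Cycle-edges↔ n′ μ = ↔-sym Finₚ.*↔×

StandardComponent : ℕ → Graph → ℕ → Set
StandardComponent μ Γ₀ c = Iso Γ₀ (K2 μ)
  ⊎ (∃ λ n → 3 ≤ n × Iso Γ₀ (Cycle n μ) × c ≡ n * μ)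
  ⊎ (∃ λ s → ∃ λ t → gcd s t ≡ 1 × 1 < s * t × Iso Γ₀ (Kst s t μ) × c ≡ s * t * μ)

-- The orbit of an edge under a cyclic group

module Automorphism (Γ : FinGraph) (loopless : Loopless Γ) (g : Aut Γ) where

  open Connectivity Γ public

  Vx Ed : Set
  Vx = Fin (nv Γ)
  Ed = Fin (ne Γ)

  σ : Vx → Vx
  σ = gV g

  τ : Ed → Ed
  τ = gE g

  private
    σ⁻ : Vx → Vx
    σ⁻ = Inverse.from (Iso.isoV g)

    τ⁻ : Ed → Ed
    τ⁻ = Inverse.from (Iso.isoE g)

  σ-injective : ∀ {u w} → σ u ≡ σ w → u ≡ w
  σ-injective = Injection.injective (↔⇒↣ (Iso.isoV g))

  τ-injective : ∀ {e e′} → τ e ≡ τ e′ → e ≡ e′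
  τ-injective = Injection.injective (↔⇒↣ (Iso.isoE g))

  private
    σ⁻-injective : ∀ {u w} → σ⁻ u ≡ σ⁻ w → u ≡ w
    σ⁻-injective = Injection.injective (↔⇒↣ (↔-sym (Iso.isoV g)))

  joins⇒incident : ∀ {e u w} → Joins Γ e u w → Inc (toGraph Γ) e u × Inc (toGraph Γ) e w
  joins⇒incident (inj₁ (a , b)) = inj₁ (sym a) , inj₂ (sym b)
  joins⇒incident (inj₂ (a , b)) = inj₂ (sym b) , inj₁ (sym a)

  joins⇒≢ : ∀ {e u w} → Joins Γ e u w → u ≢ w
  joins⇒≢ {e} (inj₁ (a , b)) u≡w = loopless e (trans a (trans u≡w (sym b)))
  joins⇒≢ {e} (inj₂ (a , b)) u≡w = loopless e (trans a (trans (sym u≡w) (sym b)))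

  adjacent⇒≢ : ∀ {u w} → Adjacent Γ u w → u ≢ w
  adjacent⇒≢ (_ , j) = joins⇒≢ j

  incident⇒joins : ∀ {e u w} → Inc (toGraph Γ) e u → Inc (toGraph Γ) e w → u ≢ w → Joins Γ e u w
  incident⇒joins (inj₁ a) (inj₁ b) u≢w = ⊥-elim (u≢w (trans a (sym b)))
  incident⇒joins (inj₁ a) (inj₂ b) _   = inj₁ (sym a , sym b)
  incident⇒joins (inj₂ a) (inj₁ b) _   = inj₂ (sym b , sym a)
  incident⇒joins (inj₂ a) (inj₂ b) u≢w = ⊥-elim (u≢w (trans a (sym b)))

  incident⇒end : ∀ {e u v w} → Joins Γ e v w → Inc (toGraph Γ) e u → u ≡ v ⊎ u ≡ w
  incident⇒end (inj₁ (a , b)) (inj₁ i) = inj₁ (trans i a)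
  incident⇒end (inj₁ (a , b)) (inj₂ i) = inj₂ (trans i b)
  incident⇒end (inj₂ (a , b)) (inj₁ i) = inj₂ (trans i a)
  incident⇒end (inj₂ (a , b)) (inj₂ i) = inj₁ (trans i b)

  joins-unique : ∀ {e u w u′ w′} → Joins Γ e u w → Joins Γ e u′ w′ → (u ≡ u′ × w ≡ w′) ⊎ (u ≡ w′ × w ≡ u′)
  joins-unique (inj₁ (a , b)) (inj₁ (c , d)) = inj₁ (trans (sym a) c , trans (sym b) d)
  joins-unique (inj₁ (a , b)) (inj₂ (c , d)) = inj₂ (trans (sym a) c , trans (sym b) d)
  joins-unique (inj₂ (a , b)) (inj₁ (c , d)) = inj₂ (trans (sym b) d , trans (sym a) c)
  joins-unique (inj₂ (a , b)) (inj₂ (c , d)) = inj₁ (trans (sym b) d , trans (sym a) c)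

  joins-σ : ∀ {e u w} → Joins Γ e u w → Joins Γ (τ e) (σ u) (σ w)
  joins-σ j = let (iu , iw) = joins⇒incident j in
    incident⇒joins (Equivalence.to (Iso.inc g _ _) iu) (Equivalence.to (Iso.inc g _ _) iw)
                   (joins⇒≢ j ∘ σ-injective)

  private
    incident-σ⁻ : ∀ {e u} → Inc (toGraph Γ) e u → Inc (toGraph Γ) (τ⁻ e) (σ⁻ u)
    incident-σ⁻ {e} {u} i = Equivalence.from (Iso.inc g (τ⁻ e) (σ⁻ u))
      (subst₂ (Inc (toGraph Γ)) (sym (Inverse.strictlyInverseˡ (Iso.isoE g) e))
                                (sym (Inverse.strictlyInverseˡ (Iso.isoV g) u)) i)

    joins-σ⁻ : ∀ {e u w} → Joins Γ e u w → Joins Γ (τ⁻ e) (σ⁻ u) (σ⁻ w)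
    joins-σ⁻ j = let (iu , iw) = joins⇒incident j in
      incident⇒joins (incident-σ⁻ iu) (incident-σ⁻ iw) (joins⇒≢ j ∘ σ⁻-injective)

    ~-σ⁻ : ∀ {u w} → u ~ w → σ⁻ u ~ σ⁻ w
    ~-σ⁻ here             = here
    ~-σ⁻ (step c (e , j)) = step (~-σ⁻ c) (τ⁻ e , joins-σ⁻ j)

  joins-iter : ∀ k {e u w} → Joins Γ e u w → Joins Γ (iter τ k e) (iter σ k u) (iter σ k w)
  joins-iter zero    j = j
  joins-iter (suc k) j = joins-σ (joins-iter k j)

  adjacent-iter : ∀ k {u w} → Adjacent Γ u w → Adjacent Γ (iter σ k u) (iter σ k w)
  adjacent-iter k (e , j) = iter τ k e , joins-iter k j

  ~-iter : ∀ k {u w} → u ~ w → iter σ k u ~ iter σ k w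
  ~-iter k here       = here
  ~-iter k (step c a) = step (~-iter k c) (adjacent-iter k a)

  ~-cancel-iter : ∀ k {u w} → iter σ k u ~ iter σ k w → u ~ w
  ~-cancel-iter zero    c = c
  ~-cancel-iter (suc k) c = ~-cancel-iter k (subst₂ _~_ (σ⁻σ _) (σ⁻σ _) (~-σ⁻ c))
    where
      σ⁻σ : ∀ u → σ⁻ (σ u) ≡ u
      σ⁻σ = Inverse.strictlyInverseʳ (Iso.isoV g)

  module EdgeOrbit (noIsolated : NoIsolated Γ) (edgeTransitive : EdgeTransitive g) (e₀ : Ed) where

    a₀ b₀ : Vx
    a₀ = proj₁ (fends Γ e₀)
    b₀ = proj₂ (fends Γ e₀)

    x y : ℕ → Vx
    x k = iter σ k a₀
    y k = iter σ k b₀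

    edge : ℕ → Ed
    edge k = iter τ k e₀

    edge-joins : ∀ k → Joins Γ (edge k) (x k) (y k)
    edge-joins k = joins-iter k (inj₁ (refl , refl))

    x-adjacent-y : ∀ k → Adjacent Γ (x k) (y k)
    x-adjacent-y k = edge k , edge-joins k

    x~y : ∀ k → x k ~ y k
    x~y k = adjacent⇒~ (x-adjacent-y k)

    x-+ : ∀ i j → x (i + j) ≡ iter σ i (x j)
    x-+ i j = iter-+ σ i j a₀

    y-+ : ∀ i j → y (i + j) ≡ iter σ i (y j)
    y-+ i j = iter-+ σ i j b₀

    vertex-in-orbit : ∀ u → ∃ λ k → u ≡ x k ⊎ u ≡ y k
    vertex-in-orbit u with noIsolated u
    ... | e , inc with edgeTransitive e₀ e
    ... | k , refl = k , incident⇒end (edge-joins k) inc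

    adjacent-in-orbit : ∀ {u w} → Adjacent Γ u w → ∃ λ k → (u ≡ x k × w ≡ y k) ⊎ (u ≡ y k × w ≡ x k)
    adjacent-in-orbit (e , j) with edgeTransitive e₀ e
    ... | k , refl with joins-unique (edge-joins k) j
    ... | inj₁ (a , b) = k , inj₁ (sym a , sym b)
    ... | inj₂ (a , b) = k , inj₂ (sym b , sym a)

    first-end : ∀ k → proj₁ (fends Γ (edge k)) ≡ x k ⊎ proj₁ (fends Γ (edge k)) ≡ y k
    first-end k with edge-joins k
    ... | inj₁ (a , _) = inj₁ a
    ... | inj₂ (a , _) = inj₂ a

    a₀~x-* : ∀ {e} → a₀ ~ x e → ∀ w → a₀ ~ x (w * e)
    a₀~x-* c zero    = here
    a₀~x-* {e} c (suc w) = ~-trans c (subst (x e ~_) (sym (x-+ e (w * e))) (~-iter e (a₀~x-* c w)))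

    module Order (m′ : ℕ) (order : IsOrder g (suc m′)) where

      m : ℕ
      m = suc m′

      σ^m≡id : ∀ v → iter σ m v ≡ v
      σ^m≡id = proj₁ (proj₁ (proj₂ order))

      τ^m≡id : ∀ e → iter τ m e ≡ e
      τ^m≡id = proj₂ (proj₁ (proj₂ order))

      private
        powIsId-% : ∀ j → PowIsId g j → PowIsId g (j % m)
        powIsId-% j (σ^j≡id , τ^j≡id) = (λ v → trans (sym (iter-%-fixed σ (σ^m≡id v) j)) (σ^j≡id v))
                                       , (λ e → trans (sym (iter-%-fixed τ (τ^m≡id e) j)) (τ^j≡id e))

      powIsId⇒∣ : ∀ j → PowIsId g j → m ∣ j
      powIsId⇒∣ j g^j≡id with j % m in eq
      ... | zero  = m%n≡0⇒n∣m j m eq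
      ... | suc r = ⊥-elim (proj₂ (proj₂ order) (suc r) (s≤s z≤n) (subst (_< m) eq (m%n<n j m))
                                                (subst (PowIsId g) eq (powIsId-% j g^j≡id)))

      -- Every vertex and edge lies in the ⟨g⟩-orbit of a₀, b₀ or e₀, and g^j commutes with g.
      fixes-e₀-pointwise⇒∣ : ∀ j → edge j ≡ e₀ → x j ≡ a₀ → y j ≡ b₀ → m ∣ j
      fixes-e₀-pointwise⇒∣ j edge-fixed a₀-fixed b₀-fixed = powIsId⇒∣ j (fixes-vertices , fixes-edges)
        where
          fixes-vertices : ∀ v → iter σ j v ≡ v
          fixes-vertices v with vertex-in-orbit v
          ... | k , inj₁ refl = trans (iter-comm σ j k a₀) (cong (iter σ k) a₀-fixed)
          ... | k , inj₂ refl = trans (iter-comm σ j k b₀) (cong (iter σ k) b₀-fixed)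
          fixes-edges : ∀ e → iter τ j e ≡ e
          fixes-edges e with edgeTransitive e₀ e
          ... | k , refl = trans (iter-comm τ j k e₀) (cong (iter τ k) edge-fixed)

      module _ (no-reversal : ∀ j → x j ≡ b₀ → y j ≡ a₀ → ⊥) where

        edge-stabiliser-trivial : ∀ j → edge j ≡ e₀ → m ∣ j
        edge-stabiliser-trivial j edge-fixed
          with joins-unique (subst (λ e → Joins Γ e (x j) (y j)) edge-fixed (edge-joins j)) (inj₁ (refl , refl))
        ... | inj₁ (a₀-fixed , b₀-fixed) = fixes-e₀-pointwise⇒∣ j edge-fixed a₀-fixed b₀-fixed
        ... | inj₂ (xj≡b₀ , yj≡a₀)       = ⊥-elim (no-reversal j xj≡b₀ yj≡a₀)

        private
          edge-≢-below : ∀ i j → i < j → j < m → edge i ≢ edge j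
          edge-≢-below i j i<j j<m eq = <⇒≱ (≤-<-trans (m∸n≤m j i) j<m) (∣⇒≤ ⦃ >-nonZero (m<n⇒0<n∸m i<j) ⦄ m∣j∸i)
            where
              m∣j∸i : m ∣ (j ∸ i)
              m∣j∸i = edge-stabiliser-trivial (j ∸ i) (iter-injective τ τ-injective i (begin
                iter τ i (edge (j ∸ i)) ≡⟨ iter-+ τ i (j ∸ i) e₀ ⟨
                edge (i + (j ∸ i))      ≡⟨ cong edge (m+[n∸m]≡n (<⇒≤ i<j)) ⟩
                edge j                  ≡⟨ eq ⟨
                edge i                  ∎))
                where open ≡-Reasoning

        edge-injective-below : ∀ i j → i < m → j < m → edge i ≡ edge j → i ≡ j
        edge-injective-below i j i<m j<m eq with <-cmp i j
        ... | tri< i<j _ _ = ⊥-elim (edge-≢-below i j i<j j<m eq)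
        ... | tri≈ _ i≡j _ = i≡j
        ... | tri> _ _ j<i = ⊥-elim (edge-≢-below j i j<i i<m (sym eq))

        edges↔ : Fin m ↔ Ed
        edges↔ = mk↔ₛ′ (edge ∘ toℕ) (λ e → fromℕ< (index<m e)) to∘from from∘to
          where
            exponent : Ed → ℕ
            exponent e = proj₁ (edgeTransitive e₀ e)

            index : Ed → ℕ
            index e = exponent e % m

            index<m : ∀ e → index e < m
            index<m e = m%n<n (exponent e) m

            edge-index : ∀ e → edge (index e) ≡ e
            edge-index e = trans (sym (iter-%-fixed τ (τ^m≡id e₀) (exponent e))) (proj₂ (edgeTransitive e₀ e))

            to∘from : ∀ e → edge (toℕ (fromℕ< (index<m e))) ≡ e
            to∘from e = trans (cong edge (Finₚ.toℕ-fromℕ< (index<m e))) (edge-index e)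

            from∘to : ∀ k → fromℕ< (index<m (edge (toℕ k))) ≡ k
            from∘to k = Finₚ.toℕ-injective (trans (Finₚ.toℕ-fromℕ< _)
              (edge-injective-below _ _ (index<m (edge (toℕ k))) (Finₚ.toℕ<n k) (edge-index (edge (toℕ k)))))

    -- Labelling x i and y i by i mod d is well defined, and σ^d keeps a₀ in its component;
    -- together these make the label a complete invariant of the components.
    record ResidueLabelling (d : ℕ) .{{_ : NonZero d}} : Set where
      field
        x-≡⇒≡-mod  : ∀ i j → x i ≡ x j → i % d ≡ j % d
        y-≡⇒≡-mod  : ∀ i j → y i ≡ y j → i % d ≡ j % d
        xy-≡⇒≡-mod : ∀ i j → x i ≡ y j → i % d ≡ j % d
        a₀~x-d     : a₀ ~ x d

    module Components (d : ℕ) .{{_ : NonZero d}} (L : ResidueLabelling d) where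
      open ResidueLabelling L

      Label : ℕ → Vx → Set
      Label c u = ∃ λ j → (u ≡ x j ⊎ u ≡ y j) × j % d ≡ c % d

      private
        0%d≡0 : 0 % d ≡ 0
        0%d≡0 = m<n⇒m%n≡m (>-nonZero⁻¹ d)

        label-step : ∀ c {u w} → Label c u → Adjacent Γ u w → Label c w
        label-step c (j , u≡ , j≡c) adj with adjacent-in-orbit adj | u≡
        ... | k , inj₁ (u≡x , w≡y) | inj₁ u≡x′ = k , inj₂ w≡y , trans (x-≡⇒≡-mod k j (trans (sym u≡x) u≡x′)) j≡c
        ... | k , inj₁ (u≡x , w≡y) | inj₂ u≡y′ = k , inj₂ w≡y , trans (xy-≡⇒≡-mod k j (trans (sym u≡x) u≡y′)) j≡c
        ... | k , inj₂ (u≡y , w≡x) | inj₁ u≡x′ = k , inj₁ w≡x , trans (sym (xy-≡⇒≡-mod j k (trans (sym u≡x′) u≡y))) j≡c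
        ... | k , inj₂ (u≡y , w≡x) | inj₂ u≡y′ = k , inj₁ w≡x , trans (y-≡⇒≡-mod k j (trans (sym u≡y) u≡y′)) j≡c

      ~⇒label : ∀ c {u} → x c ~ u → Label c u
      ~⇒label c here         = c , inj₁ refl , refl
      ~⇒label c (step c~ adj) = label-step c (~⇒label c c~) adj

      x~x-+* : ∀ c t → x c ~ x (c + t * d)
      x~x-+* c t = subst (x c ~_) (sym (x-+ c (t * d))) (~-iter c (a₀~x-* a₀~x-d t))

      x-%~x : ∀ k → x (k % d) ~ x k
      x-%~x k = subst (x (k % d) ~_) (cong x (sym (m≡m%n+[m/n]*n k d))) (x~x-+* (k % d) (k / d))

      ≡-mod⇒x~x : ∀ i j → i % d ≡ j % d → x i ~ x j
      ≡-mod⇒x~x i j eq = ~-trans (~-sym (x-%~x i)) (subst (λ k → x k ~ x j) (sym eq) (x-%~x j))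

      x~x⇒≡-mod : ∀ i j → x i ~ x j → i % d ≡ j % d
      x~x⇒≡-mod i j c with ~⇒label i c
      ... | k , inj₁ xj≡xk , k≡i = sym (trans (x-≡⇒≡-mod j k xj≡xk) k≡i)
      ... | k , inj₂ xj≡yk , k≡i = sym (trans (xy-≡⇒≡-mod j k xj≡yk) k≡i)

      component-index : Vx → Fin d
      component-index u = fromℕ< (m%n<n (proj₁ (vertex-in-orbit u)) d)

      component-index-~ : ∀ u → x (toℕ (component-index u)) ~ u
      component-index-~ u with vertex-in-orbit u
      ... | k , inj₁ u≡x = subst₂ _~_ (cong x (sym (Finₚ.toℕ-fromℕ< (m%n<n k d)))) (sym u≡x) (x-%~x k)
      ... | k , inj₂ u≡y = subst₂ _~_ (cong x (sym (Finₚ.toℕ-fromℕ< (m%n<n k d)))) (sym u≡y) (~-trans (x-%~x k) (x~y k))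

      numComponents : NumComponents Γ d
      numComponents = (λ i → x (toℕ i)) , disjoint , (λ v → component-index v , component-index-~ v)
        where
          disjoint : ∀ i j → x (toℕ i) ~ x (toℕ j) → i ≡ j
          disjoint i j c = Finₚ.toℕ-injective (begin
            toℕ i     ≡⟨ m<n⇒m%n≡m (Finₚ.toℕ<n i) ⟨
            toℕ i % d ≡⟨ x~x⇒≡-mod (toℕ i) (toℕ j) c ⟩
            toℕ j % d ≡⟨ m<n⇒m%n≡m (Finₚ.toℕ<n j) ⟩
            toℕ j     ∎)
            where open ≡-Reasoning

      every-component-iso : ∀ {Γ₀} → (∀ c → c < d → Iso (Component Γ (x c)) Γ₀) → ∀ v → Iso (Component Γ v) Γ₀
      every-component-iso base-iso v = iso-trans (~⇒component-iso (~-sym (component-index-~ v)))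
                                           (base-iso _ (Finₚ.toℕ<n (component-index v)))

      private
        v~σ^k-v⇔a₀~x-k : ∀ v k → v ~ iter σ k v ⇔ a₀ ~ x k
        v~σ^k-v⇔a₀~x-k v k = mk⇔
          (λ v~ → ~-cancel-iter c (subst (x c ~_) (iter-comm σ k c a₀)
                     (~-trans c~v (~-trans v~ (~-iter k (~-sym c~v))))))
          (λ a₀~ → ~-trans (~-sym c~v) (~-trans (subst (x c ~_) (iter-comm σ c k a₀) (~-iter c a₀~)) (~-iter k c~v)))
          where
            c   = toℕ (component-index v)
            c~v = component-index-~ v

      a₀~x⇔∣ : ∀ k → a₀ ~ x k ⇔ d ∣ k
      a₀~x⇔∣ k = mk⇔ (λ a₀~ → m%n≡0⇒n∣m k d (trans (sym (x~x⇒≡-mod 0 k a₀~)) 0%d≡0))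
                     (λ d∣k → ≡-mod⇒x~x 0 k (trans 0%d≡0 (sym (n∣m⇒m%n≡0 k d d∣k))))

      stabComp⇔∣ : ∀ v k → StabComp g v k ⇔ d ∣ k
      stabComp⇔∣ v k = mk⇔
        (λ stab → Equivalence.to (a₀~x⇔∣ k) (Equivalence.to (v~σ^k-v⇔a₀~x-k v k) (Equivalence.to (stab v) here)))
        (λ d∣k u → let v~ = Equivalence.from (v~σ^k-v⇔a₀~x-k v k) (Equivalence.from (a₀~x⇔∣ k) d∣k) in
          mk⇔ (λ v~u → ~-trans v~ (~-iter k v~u)) (λ v~σu → ~-cancel-iter k (~-trans (~-sym v~) v~σu)))

      a₀~first-end⇔∣ : ∀ k → a₀ ~ proj₁ (fends Γ (edge k)) ⇔ d ∣ k
      a₀~first-end⇔∣ k with first-end k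
      ... | inj₁ end≡x = subst (λ u → a₀ ~ u ⇔ d ∣ k) (sym end≡x) (a₀~x⇔∣ k)
      ... | inj₂ end≡y = subst (λ u → a₀ ~ u ⇔ d ∣ k) (sym end≡y)
            (mk⇔ (λ a₀~y → Equivalence.to (a₀~x⇔∣ k) (~-trans a₀~y (~-sym (x~y k))))
                 (λ d∣k → ~-trans (Equivalence.from (a₀~x⇔∣ k) d∣k) (x~y k)))

      module Stabiliser (m′ : ℕ) (order : IsOrder g (suc m′)) where
        open Order m′ order

        d∣m : d ∣ m
        d∣m = Equivalence.to (a₀~x⇔∣ m) (subst (a₀ ~_) (sym (σ^m≡id a₀)) here)

        m≡d*[m/d] : m ≡ d * (m / d)
        m≡d*[m/d] = sym (m*[n/m]≡n d∣m)

        stabCard : ∀ v → StabCard g m v (m / d)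
        stabCard v = multiples-below↔ (stabComp⇔∣ v) d∣m

        component-edges↔ : (∀ j → x j ≡ b₀ → y j ≡ a₀ → ⊥) → Fin (m / d) ↔ E (Component Γ a₀)
        component-edges↔ no-reversal = ↔-trans (multiples-below↔ a₀~first-end⇔∣ d∣m) (Σ-↔ (edges↔ no-reversal) ↔-refl)

    record ComponentShape (μ : ℕ) : Set₁ where
      field
        pred-modulus : ℕ
        labelling    : ResidueLabelling (suc pred-modulus)
        Γ₀           : Graph
        base-iso     : ∀ c → c < suc pred-modulus → Iso (Component Γ (x c)) Γ₀
        standard     : ∀ m′ → IsOrder g (suc m′) → StandardComponent μ Γ₀ (suc m′ / suc pred-modulus)

    component-stabiliser-order : ∀ {d′ M k} (L : ResidueLabelling (suc d′)) → (∀ j → x j ≡ b₀ → y j ≡ a₀ → ⊥) →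
      Iso (Component Γ a₀) M → E M ↔ Fin k → ∀ m′ → IsOrder g (suc m′) → suc m′ / suc d′ ≡ k
    component-stabiliser-order {d′} L no-reversal iso count m′ order =
      ↔⇒≡ (↔-trans (component-edges↔ no-reversal) (↔-trans (Iso.isoE iso) count))
      where open Components (suc d′) L
            open Stabiliser m′ order

    module Shapes (μ : ℕ) (constMult : ConstMult Γ μ) where
      open ComponentModel Γ μ constMult
      module σ-Period = Period σ σ-injective
      open σ-Period using (MinimalPeriod; minimalPeriod)
      open MinimalPeriod using (pred-period; periodic)

      p′ q′ p q : ℕ
      p′ = pred-period (minimalPeriod a₀)
      q′ = pred-period (minimalPeriod b₀)
      p  = suc p′
      q  = suc q′

      x-≡⇒≡-mod-p : ∀ i j → x i ≡ x j → i % p ≡ j % p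
      x-≡⇒≡-mod-p = σ-Period.iter-≡⇒%-≡ (minimalPeriod a₀)

      y-≡⇒≡-mod-q : ∀ i j → y i ≡ y j → i % q ≡ j % q
      y-≡⇒≡-mod-q = σ-Period.iter-≡⇒%-≡ (minimalPeriod b₀)

      x-+*p : ∀ i w → x (i + w * p) ≡ x i
      x-+*p = iter-+*-fixed σ (periodic (minimalPeriod a₀))

      y-+*q : ∀ i w → y (i + w * q) ≡ y i
      y-+*q = iter-+*-fixed σ (periodic (minimalPeriod b₀))

      x-%p : ∀ i → x i ≡ x (i % p)
      x-%p = iter-%-fixed σ (periodic (minimalPeriod a₀))

      x-≡-mod-p : ∀ {i j} u w → i + u * p ≡ j + w * p → x i ≡ x j
      x-≡-mod-p {i} {j} u w eq = trans (sym (x-+*p i u)) (trans (cong x eq) (x-+*p j w))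

      y-≡-mod-q : ∀ {i j} u w → i + u * q ≡ j + w * q → y i ≡ y j
      y-≡-mod-q {i} {j} u w eq = trans (sym (y-+*q i u)) (trans (cong y eq) (y-+*q j w))

      a₀~x-gcd : ∀ e d′ → gcd e p ≡ suc d′ → a₀ ~ x e → a₀ ~ x (suc d′)
      a₀~x-gcd e d′ gcd≡ a₀~x-e with bezout-mod e p′ d′ gcd≡
      ... | X , W , eq = subst (a₀ ~_) (x-≡-mod-p 1 W (trans (cong (X * e +_) (*-identityˡ p)) eq)) (a₀~x-* a₀~x-e X)

      b₀-in-orbit? : (∃ λ a → x a ≡ b₀) ⊎ (∀ i → x i ≢ b₀)
      b₀-in-orbit? with Finₚ.any? (λ (i : Fin p) → x (toℕ i) Finₚ.≟ b₀)
      ... | yes (i , eq) = inj₁ (toℕ i , eq)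
      ... | no  none     = inj₂ (λ i eq → none (fromℕ< (m%n<n i p)
                                                , trans (cong x (Finₚ.toℕ-fromℕ< (m%n<n i p))) (trans (sym (x-%p i)) eq)))

      -- Coordinates on the σ-orbit of z (period r) within the residue class c modulo d ∣ r.
      module Coordinates {z : Vx} (P : MinimalPeriod z) {d : ℕ} .{{_ : NonZero d}} (d∣r : d ∣ suc (pred-period P))
                         {c : ℕ} (c<d : c < d) where
        private
          r : ℕ
          r = suc (pred-period P)
          o : ℕ → Vx
          o k = iter σ k z

        r/d*d≡r : r / d * d ≡ r
        r/d*d≡r = m/n*n≡m d∣r

        coordinate : ℕ → ℕ
        coordinate k = (k % r) / d

        coordinate< : ∀ k → coordinate k < r / d
        coordinate< k = m<n*o⇒m/o<n (subst (k % r <_) (sym r/d*d≡r) (m%n<n k r))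

        coordinate-unique : ∀ α → α < r / d → ∀ k → o (c + α * d) ≡ o k → coordinate k ≡ α
        coordinate-unique α α<r/d k eq = begin
          (k % r) / d             ≡⟨ cong (_/ d) (σ-Period.iter-≡⇒%-≡ P (c + α * d) k eq) ⟨
          ((c + α * d) % r) / d   ≡⟨ cong (_/ d) (m<n⇒m%n≡m (subst (c + α * d <_) r/d*d≡r (c+αd<sd c<d α<r/d))) ⟩
          (c + α * d) / d         ≡⟨ [c+αd]/d≡α α c<d ⟩
          α                       ∎
          where open ≡-Reasoning

        coordinate-recovers : ∀ k → k % d ≡ c → o (c + coordinate k * d) ≡ o k
        coordinate-recovers k k≡c = begin
          o (c + coordinate k * d)          ≡⟨ cong (λ c′ → o (c′ + coordinate k * d))
                                                    (trans (sym k≡c) (sym (m∣n⇒o%n%m≡o%m d r k d∣r))) ⟩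
          o (k % r % d + (k % r) / d * d)   ≡⟨ cong o (m≡m%n+[m/n]*n (k % r) d) ⟨
          o (k % r)                         ≡⟨ iter-%-fixed σ {p = r} (periodic P) k ⟨
          o k                               ∎
          where open ≡-Reasoning

      module OffOrbit (b₀∉ : ∀ i → x i ≢ b₀) where

        x≢y : ∀ i j → x i ≢ y j
        x≢y i j eq = b₀∉ (j * q′ + i) (sym (begin
          b₀                    ≡⟨ iter-*-fixed σ (periodic (minimalPeriod b₀)) j ⟨
          iter σ (j * q) b₀     ≡⟨ cong (λ k → iter σ k b₀) (trans (*-suc j q′) (+-comm j (j * q′))) ⟩
          iter σ (j * q′ + j) b₀ ≡⟨ y-+ (j * q′) j ⟩
          iter σ (j * q′) (y j) ≡⟨ cong (iter σ (j * q′)) eq ⟨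
          iter σ (j * q′) (x i) ≡⟨ x-+ (j * q′) i ⟨
          x (j * q′ + i)        ∎))
          where open ≡-Reasoning

        no-reversal : ∀ j → x j ≡ b₀ → y j ≡ a₀ → ⊥
        no-reversal j xj≡b₀ _ = b₀∉ j xj≡b₀

        x-¬adjacent-x : ∀ i j → ¬ Adjacent Γ (x i) (x j)
        x-¬adjacent-x i j adj with adjacent-in-orbit adj
        ... | k , inj₁ (_ , xj≡yk) = x≢y j k xj≡yk
        ... | k , inj₂ (xi≡yk , _) = x≢y i k xi≡yk

        y-¬adjacent-y : ∀ i j → ¬ Adjacent Γ (y i) (y j)
        y-¬adjacent-y i j adj with adjacent-in-orbit adj
        ... | k , inj₁ (yi≡xk , _) = x≢y k i (sym yi≡xk)
        ... | k , inj₂ (_ , yj≡xk) = x≢y k j (sym yj≡xk)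

        -- σ^q fixes every y j, and σ^p every x i.
        x-shift-adjacent : ∀ {i j} → Adjacent Γ (x i) (y j) → ∀ N → Adjacent Γ (x (N * q + i)) (y j)
        x-shift-adjacent {i} {j} adj N = subst₂ (Adjacent Γ) (sym (x-+ (N * q) i))
          (trans (iter-comm σ (N * q) j b₀) (cong (iter σ j) (iter-*-fixed σ (periodic (minimalPeriod b₀)) N)))
          (adjacent-iter (N * q) adj)

        y-shift-adjacent : ∀ {i j} → Adjacent Γ (x i) (y j) → ∀ N → Adjacent Γ (x i) (y (N * p + j))
        y-shift-adjacent {i} {j} adj N = subst₂ (Adjacent Γ)
          (trans (iter-comm σ (N * p) i a₀) (cong (iter σ i) (iter-*-fixed σ (periodic (minimalPeriod a₀)) N)))
          (sym (y-+ (N * p) j)) (adjacent-iter (N * p) adj)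

        module _ (d′ : ℕ) (gcd≡ : gcd p q ≡ suc d′) where
          private
            d : ℕ
            d = suc d′

          d∣p : d ∣ p
          d∣p = subst (_∣ p) gcd≡ (gcd[m,n]∣m p q)

          d∣q : d ∣ q
          d∣q = subst (_∣ q) gcd≡ (gcd[m,n]∣n p q)

          a₀~x-q : a₀ ~ x q
          a₀~x-q = ~-trans (x~y 0) (subst (_~ x q) (periodic (minimalPeriod b₀)) (~-sym (x~y q)))

          labelling : ResidueLabelling d
          labelling = record
            { x-≡⇒≡-mod  = λ i j eq → ≡-mod-divisor d∣p i j (x-≡⇒≡-mod-p i j eq)
            ; y-≡⇒≡-mod  = λ i j eq → ≡-mod-divisor d∣q i j (y-≡⇒≡-mod-q i j eq)
            ; xy-≡⇒≡-mod = λ i j eq → ⊥-elim (x≢y i j eq)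
            ; a₀~x-d     = a₀~x-gcd q d′ (trans (gcd-comm q p) gcd≡) a₀~x-q
            }

          open Components d labelling using (Label; ~⇒label; x~x-+*)

          s t : ℕ
          s = p / d
          t = q / d

          0<s : 0 < s
          0<s = m≥n⇒m/n>0 (∣⇒≤ d∣p)

          0<t : 0 < t
          0<t = m≥n⇒m/n>0 (∣⇒≤ d∣q)

          gcd[s,t]≡1 : gcd s t ≡ 1
          gcd[s,t]≡1 = *-cancelˡ-≡ (gcd s t) 1 d (begin
            d * gcd s t               ≡⟨ c*gcd[m,n]≡gcd[cm,cn] d s t ⟩
            gcd (d * s) (d * t)       ≡⟨ cong₂ gcd (m*[n/m]≡n d∣p) (m*[n/m]≡n d∣q) ⟩
            gcd p q                   ≡⟨ gcd≡ ⟩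
            d                         ≡⟨ *-identityʳ d ⟨
            d * 1                     ∎)
            where open ≡-Reasoning

          module _ (c : ℕ) (c<d : c < d) where
            private
              module X = Coordinates (minimalPeriod a₀) d∣p c<d
              module Y = Coordinates (minimalPeriod b₀) d∣q c<d

              φ : Fin s ⊎ Fin t → Vx
              φ (inj₁ α) = x (c + toℕ α * d)
              φ (inj₂ β) = y (c + toℕ β * d)

              φ⁻¹-from : ∀ {u} → (∃ λ k → u ≡ x k ⊎ u ≡ y k) → Fin s ⊎ Fin t
              φ⁻¹-from (k , inj₁ _) = inj₁ (fromℕ< {n = s} (X.coordinate< k))
              φ⁻¹-from (k , inj₂ _) = inj₂ (fromℕ< {n = t} (Y.coordinate< k))

              φ⁻¹ : Vx → Fin s ⊎ Fin t
              φ⁻¹ u = φ⁻¹-from (vertex-in-orbit u)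

              φ⁻¹-φ : ∀ w → φ⁻¹ (φ w) ≡ w
              φ⁻¹-φ w = go w (vertex-in-orbit (φ w))
                where
                  go : ∀ w (k : ∃ λ k → φ w ≡ x k ⊎ φ w ≡ y k) → φ⁻¹-from k ≡ w
                  go (inj₁ α) (k , inj₁ eq) = cong inj₁ (Finₚ.toℕ-injective
                    (trans (Finₚ.toℕ-fromℕ< (X.coordinate< k)) (X.coordinate-unique (toℕ α) (Finₚ.toℕ<n α) k eq)))
                  go (inj₁ α) (k , inj₂ eq) = ⊥-elim (x≢y (c + toℕ α * d) k eq)
                  go (inj₂ β) (k , inj₁ eq) = ⊥-elim (x≢y k (c + toℕ β * d) (sym eq))
                  go (inj₂ β) (k , inj₂ eq) = cong inj₂ (Finₚ.toℕ-injective
                    (trans (Finₚ.toℕ-fromℕ< (Y.coordinate< k)) (Y.coordinate-unique (toℕ β) (Finₚ.toℕ<n β) k eq)))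

              φ-φ⁻¹ : ∀ u → x c ~ u → φ (φ⁻¹ u) ≡ u
              φ-φ⁻¹ u c~u = go (vertex-in-orbit u) (~⇒label c c~u)
                where
                  open ResidueLabelling labelling

                  k≡c : ∀ k j → k % d ≡ j % d → j % d ≡ c % d → k % d ≡ c
                  k≡c _ _ k≡j j≡c = trans k≡j (trans j≡c (m<n⇒m%n≡m c<d))

                  go : (k : ∃ λ k → u ≡ x k ⊎ u ≡ y k) → Label c u → φ (φ⁻¹-from k) ≡ u
                  go (k , inj₁ u≡x) (j , inj₁ u≡x′ , j≡c) =
                    trans (cong (λ i → x (c + i * d)) (Finₚ.toℕ-fromℕ< (X.coordinate< k)))
                          (trans (X.coordinate-recovers k (k≡c k j (x-≡⇒≡-mod k j (trans (sym u≡x) u≡x′)) j≡c)) (sym u≡x))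
                  go (k , inj₁ u≡x) (j , inj₂ u≡y , _) = ⊥-elim (x≢y k j (trans (sym u≡x) u≡y))
                  go (k , inj₂ u≡y) (j , inj₁ u≡x , _) = ⊥-elim (x≢y j k (trans (sym u≡x) u≡y))
                  go (k , inj₂ u≡y) (j , inj₂ u≡y′ , j≡c) =
                    trans (cong (λ i → y (c + i * d)) (Finₚ.toℕ-fromℕ< (Y.coordinate< k)))
                          (trans (Y.coordinate-recovers k (k≡c k j (y-≡⇒≡-mod k j (trans (sym u≡y) u≡y′)) j≡c)) (sym u≡y))

              x-c~φ : ∀ w → x c ~ φ w
              x-c~φ (inj₁ α) = x~x-+* c (toℕ α)
              x-c~φ (inj₂ β) = ~-trans (x~x-+* c (toℕ β)) (x~y (c + toℕ β * d))

              -- Shift the edge x c — y c along x by a multiple of q, then along y by a multiple of p;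
              -- Bézout makes the shifts land on the residues c + α d and c + β d.
              φ-adjacent : ∀ (ij : Fin s × Fin t) → Adjacent Γ (x (c + toℕ (proj₁ ij) * d)) (y (c + toℕ (proj₂ ij) * d))
              φ-adjacent (α , β) with bezout-mod q p′ d′ (trans (gcd-comm q p) gcd≡) | bezout-mod p q′ d′ gcd≡
              ... | X , W , eqX | Y , W′ , eqY =
                subst (Adjacent Γ (x (c + A * d))) y-lands (y-shift-adjacent {c + A * d} {c} x-shifted (B * Y))
                where
                  A B : ℕ
                  A = toℕ α
                  B = toℕ β

                  x-lands : x (A * X * q + c) ≡ x (c + A * d)
                  x-lands = x-≡-mod-p {A * X * q + c} {c + A * d} A (A * W) (≡-mod-scale A c eqX)

                  y-lands : y (B * Y * p + c) ≡ y (c + B * d)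
                  y-lands = y-≡-mod-q {B * Y * p + c} {c + B * d} B (B * W′) (≡-mod-scale B c eqY)

                  x-shifted : Adjacent Γ (x (c + A * d)) (y c)
                  x-shifted = subst (λ z → Adjacent Γ z (y c)) x-lands (x-shift-adjacent {c} {c} (x-adjacent-y c) (A * X))

              pair : Fin s ⊎ Fin t → Fin s ⊎ Fin t → Fin s × Fin t
              pair (inj₁ i) (inj₂ j) = i , j
              pair (inj₂ j) (inj₁ i) = i , j
              pair (inj₁ i) (inj₁ _) = i , fromℕ< 0<t
              pair (inj₂ j) (inj₂ _) = fromℕ< 0<s , j

              pair-spans : ∀ w w′ → Adjacent Γ (φ w) (φ w′) → Blowup.Spans (Kst-blowup s t μ) (pair w w′) w w′
              pair-spans (inj₁ i) (inj₂ j) _   = inj₁ (refl , refl)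
              pair-spans (inj₂ j) (inj₁ i) _   = inj₂ (refl , refl)
              pair-spans (inj₁ i) (inj₁ i′) adj = ⊥-elim (x-¬adjacent-x (c + toℕ i * d) (c + toℕ i′ * d) adj)
              pair-spans (inj₂ j) (inj₂ j′) adj = ⊥-elim (y-¬adjacent-y (c + toℕ j * d) (c + toℕ j′ * d) adj)

            component≅Kst : Iso (Component Γ (x c)) (Kst s t μ)
            component≅Kst = parametrisation⇒iso (Kst-blowup s t μ) record
              { φ = φ ; φ⁻¹ = φ⁻¹ ; φ⁻¹-φ = φ⁻¹-φ ; φ-φ⁻¹ = φ-φ⁻¹ ; v~φ = x-c~φ ; φ-adjacent = φ-adjacent
              ; pair = pair ; pair-spans = pair-spans }

          shape : ComponentShape μ
          shape = record
            { pred-modulus = d′ ; labelling = labelling ; Γ₀ = Kst s t μ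
            ; base-iso = component≅Kst ; standard = standard }
            where
              standard : ∀ m′ → IsOrder g (suc m′) → StandardComponent μ (Kst s t μ) (suc m′ / d)
              standard m′ order with s * t ≤? 1
              ... | yes st≤1 = let (s≡1 , t≡1) = m*n≤1⇒m≡1×n≡1 0<s 0<t st≤1 in
                inj₁ (subst₂ (λ s t → Iso (Kst s t μ) (K2 μ)) (sym s≡1) (sym t≡1) (Kst-1-1≅K2 μ))
              ... | no  st≰1 = inj₂ (inj₂ (s , t , gcd[s,t]≡1 , ≰⇒> st≰1 , iso-refl ,
                component-stabiliser-order labelling no-reversal (component≅Kst 0 (s≤s z≤n))
                                           (Kst-edges↔ s t μ) m′ order))

      module InOrbit (a : ℕ) (xa≡b₀ : x a ≡ b₀) where

        h : Vx → Vx
        h = iter σ a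

        h-injective : ∀ {u w} → h u ≡ h w → u ≡ w
        h-injective = iter-injective σ σ-injective a

        y≡h-x : ∀ j → y j ≡ h (x j)
        y≡h-x j = trans (cong (iter σ j) (sym xa≡b₀)) (iter-comm σ j a a₀)

        vertex-on-x : ∀ u → ∃ λ j → u ≡ x j
        vertex-on-x u with vertex-in-orbit u
        ... | j , inj₁ u≡x = j , u≡x
        ... | j , inj₂ u≡y = j + a , trans u≡y (trans (cong (iter σ j) (sym xa≡b₀)) (sym (iter-+ σ j a a₀)))

        adjacent-h : ∀ u → Adjacent Γ u (h u)
        adjacent-h u with vertex-on-x u
        ... | j , refl = subst (Adjacent Γ (x j)) (y≡h-x j) (x-adjacent-y j)

        adjacent⇒h : ∀ {u w} → Adjacent Γ u w → w ≡ h u ⊎ u ≡ h w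
        adjacent⇒h adj with adjacent-in-orbit adj
        ... | k , inj₁ (u≡x , w≡y) = inj₁ (trans w≡y (trans (y≡h-x k) (cong h (sym u≡x))))
        ... | k , inj₂ (u≡y , w≡x) = inj₂ (trans u≡y (trans (y≡h-x k) (cong h (sym w≡x))))

        ~-h^ : ∀ c k → x c ~ iter h k (x c)
        ~-h^ c zero    = here
        ~-h^ c (suc k) = step (~-h^ c k) (adjacent-h _)

        -- h commutes with σ, so every x c has the same h-period as a₀.
        h^-x : ∀ i c → iter h i (x c) ≡ iter σ c (iter h i a₀)
        h^-x i c = begin
          iter h i (x c)          ≡⟨ iter-iter σ a i (x c) ⟩
          iter σ (i * a) (x c)    ≡⟨ iter-comm σ (i * a) c a₀ ⟩
          iter σ c (x (i * a))    ≡⟨ cong (iter σ c) (iter-iter σ a i a₀) ⟨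
          iter σ c (iter h i a₀)  ∎
          where open ≡-Reasoning

        module h-Period = Period h h-injective

        -- Every x c lies on an h-cycle of length suc n′.
        HOrbitLength : ℕ → Set
        HOrbitLength n′ = ∀ c i j → iter h i (x c) ≡ iter h j (x c) ⇔ i % suc n′ ≡ j % suc n′

        h-orbit-length : ∀ (P : h-Period.MinimalPeriod a₀) → HOrbitLength (h-Period.MinimalPeriod.pred-period P)
        h-orbit-length P c i j = mk⇔
          (λ eq → h-Period.iter-≡⇒%-≡ P i j (iter-injective σ σ-injective c (trans (sym (h^-x i c)) (trans eq (h^-x j c)))))
          (λ eq → trans (h^-x i c) (trans (cong (iter σ c) (h-Period.%-≡⇒iter-≡ P i j eq)) (sym (h^-x j c))))

        h-period≢1 : h-Period.MinimalPeriod.pred-period (h-Period.minimalPeriod a₀) ≢ 0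
        h-period≢1 eq = loopless e₀ (sym (trans (sym xa≡b₀)
          (subst (λ k → iter h (suc k) a₀ ≡ a₀) eq (h-Period.MinimalPeriod.periodic (h-Period.minimalPeriod a₀)))))

        module HCycle (n′ : ℕ) (h-cyclic : HOrbitLength n′) where
          private
            n : ℕ
            n = suc n′

          ~⇒h-orbit : ∀ c {u} → x c ~ u → ∃ λ k → u ≡ iter h k (x c)
          ~⇒h-orbit c here = 0 , refl
          ~⇒h-orbit c (step c~ adj) with ~⇒h-orbit c c~ | adjacent⇒h adj
          ... | k , u≡ | inj₁ w≡hu = suc k , trans w≡hu (cong h u≡)
          ... | k , u≡ | inj₂ u≡hw = k + n′ , h-injective (trans (sym u≡hw)
                (trans u≡ (sym (Equivalence.from (h-cyclic c (suc (k + n′)) k)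
                                 (trans (cong (_% n) (sym (+-suc k n′))) ([m+n]%n≡m%n k n))))))

          module _ (c : ℕ) where
            φ : Fin n → Vx
            φ i = iter h (toℕ i) (x c)

            φ-injective : ∀ {i j} → φ i ≡ φ j → i ≡ j
            φ-injective {i} {j} eq = Finₚ.toℕ-injective (begin
              toℕ i     ≡⟨ m<n⇒m%n≡m (Finₚ.toℕ<n i) ⟨
              toℕ i % n ≡⟨ Equivalence.to (h-cyclic c (toℕ i) (toℕ j)) eq ⟩
              toℕ j % n ≡⟨ m<n⇒m%n≡m (Finₚ.toℕ<n j) ⟩
              toℕ j     ∎)
              where open ≡-Reasoning

            φ-% : ∀ k → φ (fromℕ< (m%n<n k n)) ≡ iter h k (x c)
            φ-% k = trans (cong (λ i → iter h i (x c)) (Finₚ.toℕ-fromℕ< (m%n<n k n)))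
                          (Equivalence.from (h-cyclic c (k % n) k) (m%n%n≡m%n k n))

            φ⁻¹ : Vx → Fin n
            φ⁻¹ u with Finₚ.any? (λ i → φ i Finₚ.≟ u)
            ... | yes (i , _) = i
            ... | no  _       = Fin.zero

            φ⁻¹-φ : ∀ i → φ⁻¹ (φ i) ≡ i
            φ⁻¹-φ i with Finₚ.any? (λ j → φ j Finₚ.≟ φ i)
            ... | yes (j , eq) = φ-injective eq
            ... | no  none     = ⊥-elim (none (i , refl))

            φ-φ⁻¹ : ∀ u → x c ~ u → φ (φ⁻¹ u) ≡ u
            φ-φ⁻¹ u c~u with Finₚ.any? (λ i → φ i Finₚ.≟ u)
            ... | yes (i , eq) = eq
            ... | no  none     = let (k , u≡) = ~⇒h-orbit c c~u in
                                 ⊥-elim (none (fromℕ< (m%n<n k n) , trans (φ-% k) (sym u≡)))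

            x-c~φ : ∀ i → x c ~ φ i
            x-c~φ i = ~-h^ c (toℕ i)

            φ-next : ∀ i → φ (cycNext n′ i) ≡ h (φ i)
            φ-next i = φ-% (suc (toℕ i))

          no-reversal : 2 ≤ n′ → ∀ j → x j ≡ b₀ → y j ≡ a₀ → ⊥
          no-reversal 2≤n′ j xj≡b₀ yj≡a₀ =
            1+n≢0 (trans (sym (m<n⇒m%n≡m (s≤s 2≤n′))) (Equivalence.to (h-cyclic 0 2 0) h²-a₀))
            where
              open ≡-Reasoning
              h²-a₀ : h (h a₀) ≡ a₀
              h²-a₀ = begin
                h (h a₀) ≡⟨ cong h (y≡h-x 0) ⟨
                h b₀     ≡⟨ cong h xj≡b₀ ⟨
                h (x j)  ≡⟨ y≡h-x j ⟨
                y j      ≡⟨ yj≡a₀ ⟩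
                a₀       ∎

          component≅Cycle : 2 ≤ n′ → ∀ c → Iso (Component Γ (x c)) (Cycle n μ)
          component≅Cycle 2≤n′ c = parametrisation⇒iso (cycle-blowup n′ μ 2≤n′) record
            { φ = φ c ; φ⁻¹ = φ⁻¹ c ; φ⁻¹-φ = φ⁻¹-φ c ; φ-φ⁻¹ = φ-φ⁻¹ c ; v~φ = x-c~φ c
            ; φ-adjacent = λ i → subst (Adjacent Γ (φ c i)) (sym (φ-next c i)) (adjacent-h (φ c i))
            ; pair = pair ; pair-spans = pair-spans }
            where
              pair : Fin n → Fin n → Fin n
              pair i j with j Finₚ.≟ cycNext n′ i
              ... | yes _ = i
              ... | no  _ = j

              pair-spans : ∀ i j → Adjacent Γ (φ c i) (φ c j) → Blowup.Spans (cycle-blowup n′ μ 2≤n′) (pair i j) i j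
              pair-spans i j adj with j Finₚ.≟ cycNext n′ i | adjacent⇒h adj
              ... | yes j≡next-i | _            = inj₁ (refl , sym j≡next-i)
              ... | no  j≢next-i | inj₁ φj≡hφi = ⊥-elim (j≢next-i (φ-injective c (trans φj≡hφi (sym (φ-next c i)))))
              ... | no  _        | inj₂ φi≡hφj = inj₂ (refl , φ-injective c (trans (φ-next c j) (sym φi≡hφj)))

        component≅K2 : HOrbitLength 1 → ∀ c → Iso (Component Γ (x c)) (K2 μ)
        component≅K2 h-cyclic c = parametrisation⇒iso (K2-blowup μ) record
          { φ = φ c ; φ⁻¹ = φ⁻¹ c ; φ⁻¹-φ = φ⁻¹-φ c ; φ-φ⁻¹ = φ-φ⁻¹ c ; v~φ = x-c~φ c
          ; φ-adjacent = λ _ → adjacent-h (x c) ; pair = λ _ _ → Fin.zero ; pair-spans = pair-spans }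
          where
            open HCycle 1 h-cyclic
            pair-spans : ∀ w w′ → Adjacent Γ (φ c w) (φ c w′) → Blowup.Spans (K2-blowup μ) Fin.zero w w′
            pair-spans Fin.zero           (Fin.suc Fin.zero) _   = inj₁ (refl , refl)
            pair-spans (Fin.suc Fin.zero) Fin.zero           _   = inj₂ (refl , refl)
            pair-spans Fin.zero           Fin.zero           adj = ⊥-elim (adjacent⇒≢ adj refl)
            pair-spans (Fin.suc Fin.zero) (Fin.suc Fin.zero) adj = ⊥-elim (adjacent⇒≢ adj refl)

        module _ (d′ : ℕ) (gcd≡ : gcd a p ≡ suc d′) where
          private
            d : ℕ
            d = suc d′

          d∣a : d ∣ a
          d∣a = subst (_∣ a) gcd≡ (gcd[m,n]∣m a p)

          d∣p : d ∣ p
          d∣p = subst (_∣ p) gcd≡ (gcd[m,n]∣n a p)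

          y≡x-+a : ∀ i → y i ≡ x (i + a)
          y≡x-+a i = trans (cong (iter σ i) (sym xa≡b₀)) (sym (iter-+ σ i a a₀))

          x-≡⇒≡-mod-d : ∀ i j → x i ≡ x j → i % d ≡ j % d
          x-≡⇒≡-mod-d i j eq = ≡-mod-divisor d∣p i j (x-≡⇒≡-mod-p i j eq)

          labelling : ResidueLabelling d
          labelling = record
            { x-≡⇒≡-mod  = x-≡⇒≡-mod-d
            ; y-≡⇒≡-mod  = λ i j eq → trans (sym (%-remove-+ʳ i d∣a))
                (trans (x-≡⇒≡-mod-d (i + a) (j + a) (trans (sym (y≡x-+a i)) (trans eq (y≡x-+a j)))) (%-remove-+ʳ j d∣a))
            ; xy-≡⇒≡-mod = λ i j eq → trans (x-≡⇒≡-mod-d i (j + a) (trans eq (y≡x-+a j))) (%-remove-+ʳ j d∣a)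
            ; a₀~x-d     = a₀~x-gcd a d′ gcd≡ (subst (a₀ ~_) (sym xa≡b₀) (x~y 0))
            }

          shape : ComponentShape μ
          shape = shape-for (h-Period.MinimalPeriod.pred-period P) h-period≢1 (h-orbit-length P)
            where
              P : h-Period.MinimalPeriod a₀
              P = h-Period.minimalPeriod a₀
              shape-for : ∀ n′ → n′ ≢ 0 → HOrbitLength n′ → ComponentShape μ
              shape-for zero          n′≢0 _ = ⊥-elim (n′≢0 refl)
              shape-for (suc zero)    _ h-cyclic = record
                { pred-modulus = d′ ; labelling = labelling ; Γ₀ = K2 μ
                ; base-iso = λ c _ → component≅K2 h-cyclic c ; standard = λ _ _ → inj₁ iso-refl }
              shape-for (suc (suc k)) _ h-cyclic = record
                { pred-modulus = d′ ; labelling = labelling ; Γ₀ = Cycle (3 + k) μ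
                ; base-iso = λ c _ → component≅Cycle 2≤n′ c
                ; standard = λ m′ order → inj₂ (inj₁ (3 + k , s≤s 2≤n′ , iso-refl ,
                    component-stabiliser-order labelling (no-reversal 2≤n′) (component≅Cycle 2≤n′ 0)
                                               (Cycle-edges↔ (2 + k) μ) m′ order)) }
                where
                  open HCycle (2 + k) h-cyclic
                  2≤n′ : 2 ≤ 2 + k
                  2≤n′ = s≤s (s≤s z≤n)

      shape : ComponentShape μ
      shape with b₀-in-orbit?
      ... | inj₁ (a , xa≡b₀) = let (d′ , gcd≡) = gcd≡suc a p (λ ()) in InOrbit.shape a xa≡b₀ d′ gcd≡
      ... | inj₂ b₀∉         = let (d′ , gcd≡) = gcd≡suc p q (λ ()) in OffOrbit.shape b₀∉ d′ gcd≡

corollary5p5 : (Γ : FinGraph) (μ : ℕ) → Loopless Γ → NoIsolated Γ → ConstMult Γ μ →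
    0 < ne Γ → (g : Aut Γ) → EdgeTransitive g →
    Σ ℕ λ r → Σ Graph λ Γ₀ →
      NumComponents Γ r × (∀ v → Iso (Component Γ v) Γ₀) ×
      (∀ m → IsOrder g m → ∀ v → ∃ λ c → StabCard g m v c × m ≡ r * c ×
        (Iso Γ₀ (K2 μ)
         ⊎ (∃ λ n → 3 ≤ n × Iso Γ₀ (Cycle n μ) × c ≡ n * μ)
         ⊎ (∃ λ s → ∃ λ t → gcd s t ≡ 1 × 1 < s * t × Iso Γ₀ (Kst s t μ) × c ≡ s * t * μ)))
corollary5p5 Γ μ loopless noIsolated constMult 0<ne g edgeTransitive =
  suc pred-modulus , Γ₀ , numComponents , every-component-iso base-iso , stabiliser
  where
    open Automorphism Γ loopless g
    open EdgeOrbit noIsolated edgeTransitive (fromℕ< 0<ne)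
    open ComponentShape (Shapes.shape μ constMult)
    open Components (suc pred-modulus) labelling

    stabiliser : ∀ m → IsOrder g m → ∀ v → ∃ λ c → StabCard g m v c × m ≡ suc pred-modulus * c ×
                   StandardComponent μ Γ₀ c
    stabiliser zero     (() , _)
    stabiliser (suc m′) order v = let open Stabiliser m′ order in
      suc m′ / suc pred-modulus , stabCard v , m≡d*[m/d] , standard m′ order
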